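{- Let $\mathbb{k}$ be a field of characteristic zero and $A,B$ commutative unital $\mathbb{k}$-algebras. If $f : A \to B$ is a sum $f = f_1 + \dots + f_n$ of $n$ ring homomorphisms $f_i : A \to B$, then $f$ is a Frobenius $n$-homomorphism.
   Context: "Ring homomorphism" means a $\mathbb{k}$-linear map preserving products and the unit. For a $\mathbb{k}$-linear map $f : A \to B$ and $k \ge 1$, define $\Phi_k(f)(a_1,\dots,a_k) = \sum_{\sigma \in \Sigma_k} \epsilon(\sigma) f_\sigma(a_1,\dots,a_k)$, where $\epsilon(\sigma)$ is the sign, and if $\sigma = \gamma_1\cdots\gamma_q$ is the disjoint cycle decomposition (including cycles of length one) then $f_\sigma = \prod_j f_{\gamma_j}$ with $f_\gamma(a_1,\dots,a_k) = f(a_{r_1}\cdots a_{r_j})$ for $\gamma = (r_1\,\dots\,r_j)$. $f$ is a Frobenius $n$-homomorphism if $\Phi_{n+1}(f)$ vanishes identically and $f(1) = n\cdot 1_B$. -}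

module Defs where

open import Level using (Level; _⊔_)
open import Algebra.Bundles using (CommutativeRing)
open import Algebra.Morphism.Structures using (IsRingHomomorphism)
open import Data.Nat.Base using (ℕ; zero; suc; _≤ᵇ_; _<ᵇ_)
open import Data.Fin.Base using (Fin; toℕ)
open import Data.Fin.Properties using (_≟_)
open import Data.Bool.ListAction using (and)
open import Data.Bool.Base using (Bool; true; false; not; _∧_; _∨_; if_then_else_)
open import Data.List.Base using (List; []; _∷_; [_]; map; foldr; concatMap; filterᵇ; allFin; upTo; length; cartesianProduct)
open import Data.Product.Base using (∃; _,_; _×_)
open import Relation.Nullary.Decidable.Core using (does)
open import Relation.Nullary.Negation.Core using (¬_)

module _ {c ℓ} (R : CommutativeRing c ℓ) where
  open CommutativeRing R

  natMul : ℕ → Carrier → Carrier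
  natMul zero    x = 0#
  natMul (suc n) x = x + natMul n x

  negPow : ℕ → Carrier → Carrier
  negPow zero    x = x
  negPow (suc m) x = - negPow m x

  sumL : List Carrier → Carrier
  sumL = foldr _+_ 0#

  prodL : List Carrier → Carrier
  prodL = foldr _*_ 1#

record IsField {c ℓ} (K : CommutativeRing c ℓ) : Set (c ⊔ ℓ) where
  open CommutativeRing K
  field
    0≉1     : ¬ (0# ≈ 1#)
    inverse : ∀ x → ¬ (x ≈ 0#) → ∃ λ y → x * y ≈ 1#

CharZero : ∀ {c ℓ} (K : CommutativeRing c ℓ) → Set ℓ
CharZero K = ∀ n → ¬ (natMul K (suc n) 1# ≈ 0#)
  where open CommutativeRing K

record CommAlgebra {c ℓ} (K : CommutativeRing c ℓ) (a ℓa : Level)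
       : Set (c ⊔ ℓ Level.⊔ Level.suc (a ⊔ ℓa)) where
  field
    ring  : CommutativeRing a ℓa
  open CommutativeRing ring
  field
    ι     : CommutativeRing.Carrier K → Carrier
    ι-hom : IsRingHomomorphism (CommutativeRing.rawRing K) rawRing ι

  _•_ : CommutativeRing.Carrier K → Carrier → Carrier
  k • x = ι k * x

module _ {c ℓ a ℓa b ℓb} {K : CommutativeRing c ℓ}
         (A : CommAlgebra K a ℓa) (B : CommAlgebra K b ℓb) where
  private
    module A = CommAlgebra A
    module B = CommAlgebra B
    module RA = CommutativeRing A.ring
    module RB = CommutativeRing B.ring

  record IsLinear (f : RA.Carrier → RB.Carrier) : Set (a ⊔ ℓa ⊔ c ⊔ ℓb) where
    field
      cong   : ∀ {x y} → x RA.≈ y → f x RB.≈ f y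
      +-homo : ∀ x y → f (x RA.+ y) RB.≈ f x RB.+ f y
      •-homo : ∀ k x → f (k A.• x) RB.≈ k B.• f x

  -- "ring homomorphism": k-linear map preserving products and the unit
  record IsAlgHom (f : RA.Carrier → RB.Carrier) : Set (a ⊔ ℓa ⊔ c ⊔ ℓb) where
    field
      isLinear : IsLinear f
      *-homo   : ∀ x y → f (x RA.* y) RB.≈ f x RB.* f y
      1-homo   : f RA.1# RB.≈ RB.1#

allᵇ : ∀ {x} {X : Set x} → (X → Bool) → List X → Bool
allᵇ p xs = and (map p xs)

allFuns : (n m : ℕ) → List (Fin n → Fin m)
allFuns zero    m = [ (λ ()) ]
allFuns (suc n) m =
  concatMap (λ x → map (λ g → cons x g) (allFuns n m)) (allFin m)
  where
  cons : Fin m → (Fin n → Fin m) → Fin (suc n) → Fin m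
  cons x g Fin.zero    = x
  cons x g (Fin.suc i) = g i

eqᵇ : ∀ {k} → Fin k → Fin k → Bool
eqᵇ i j = does (i ≟ j)

isInjectiveᵇ : ∀ {k} → (Fin k → Fin k) → Bool
isInjectiveᵇ {k} σ =
  allᵇ (λ i → allᵇ (λ j → not (eqᵇ (σ i) (σ j)) ∨ eqᵇ i j) (allFin k)) (allFin k)

-- Σ_k (an injective endomap of a finite set is a bijection)
perms : (k : ℕ) → List (Fin k → Fin k)
perms k = filterᵇ isInjectiveᵇ (allFuns k k)

-- number of inversions; sign ε(σ) = (-1)^inversions σ
inversions : ∀ {k} → (Fin k → Fin k) → ℕ
inversions {k} σ = length (filterᵇ inv (cartesianProduct (allFin k) (allFin k)))
  where
  inv : Fin k × Fin k → Bool
  inv (i , j) = (toℕ i <ᵇ toℕ j) ∧ (toℕ (σ j) <ᵇ toℕ (σ i))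

iter : ∀ {k} → (Fin k → Fin k) → ℕ → Fin k → Fin k
iter σ zero    i = i
iter σ (suc m) i = σ (iter σ m i)

cycleLen : ∀ {k} → (Fin k → Fin k) → Fin k → ℕ
cycleLen {k} σ i = go (map suc (upTo k))
  where
  go : List ℕ → ℕ
  go []       = k
  go (m ∷ ms) = if eqᵇ (iter σ m i) i then m else go ms

isLeader : ∀ {k} → (Fin k → Fin k) → Fin k → Bool
isLeader σ i = allᵇ (λ m → toℕ i ≤ᵇ toℕ (iter σ m i)) (upTo (cycleLen σ i))

-- one representative per cycle of σ (cycles of length one included)
cycleLeaders : ∀ {k} → (Fin k → Fin k) → List (Fin k)
cycleLeaders {k} σ = filterᵇ (isLeader σ) (allFin k)

module _ {c ℓ a ℓa b ℓb} {K : CommutativeRing c ℓ}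
         (A : CommAlgebra K a ℓa) (B : CommAlgebra K b ℓb) where
  private
    module RA = CommutativeRing (CommAlgebra.ring A)
    module RB = CommutativeRing (CommAlgebra.ring B)

  cycleProduct : ∀ {k} → (Fin k → Fin k) → (Fin k → RA.Carrier) → Fin k → RA.Carrier
  cycleProduct σ as i = prodL (CommAlgebra.ring A) (map (λ m → as (iter σ m i)) (upTo (cycleLen σ i)))

  fσ : (RA.Carrier → RB.Carrier) → ∀ {k} → (Fin k → Fin k) → (Fin k → RA.Carrier) → RB.Carrier
  fσ f σ as = prodL (CommAlgebra.ring B) (map (λ i → f (cycleProduct σ as i)) (cycleLeaders σ))

  Φ : (k : ℕ) → (RA.Carrier → RB.Carrier) → (Fin k → RA.Carrier) → RB.Carrier
  Φ k f as = sumL (CommAlgebra.ring B)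
               (map (λ σ → negPow (CommAlgebra.ring B) (inversions σ) (fσ f σ as)) (perms k))

  record IsFrobeniusHom (n : ℕ) (f : RA.Carrier → RB.Carrier) : Set (a ⊔ ℓa ⊔ c ⊔ ℓb) where
    field
      isLinear : IsLinear A B f
      Φ-vanish : ∀ (as : Fin (suc n) → RA.Carrier) → Φ (suc n) f as RB.≈ RB.0#
      unit     : f RA.1# RB.≈ natMul (CommAlgebra.ring B) n RB.1#

{-# OPTIONS --safe #-}
module Submission where

-- As every fⱼ is multiplicative, f_σ(a) = Π_γ f(a_γ) expands into the sum, over
-- the colourings c : Fin k → Fin n constant on the cycles of σ (that is, c ∘ σ = c), of
-- Πᵣ f_{c r}(a_r). Exchanging the sums over σ and over c gives
--   Φ_k(f)(a) = Σ_c (Σ_{σ ∈ Σ_k, c ∘ σ = c} ε(σ)) Πᵣ f_{c r}(a_r).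
-- For k = n + 1 every colouring repeats a colour, at some p ≠ q, and σ ↦ (p q) ∘ σ is a
-- sign-reversing involution of the stabiliser of c. Each inner sum S therefore satisfies S = -S,
-- and S = 0 because 2 is invertible in characteristic zero. The sign, defined by counting
-- inversions, is handled through the multiplicative product formula Π_{i<j} sgn(σ j - σ i).

open import Defs
open import Level using (Level)
open import Algebra.Bundles using (CommutativeMonoid; CommutativeRing)
open import Algebra.Morphism.Structures using (IsRingHomomorphism)
open import Data.Bool.Base using (Bool; true; false; if_then_else_; _∧_; _∨_; not; T)
import Data.Bool.Properties as Bool
open import Data.Fin.Base using (Fin; zero; suc; toℕ)
import Data.Fin.Properties as Fin
open import Data.List.Base
  using (List; []; _∷_; _++_; map; applyUpTo; upTo; length; foldr; concatMap; filterᵇ; allFin; cartesianProduct)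
open import Data.List.Properties using (map-∘; map-tabulate; map-applyUpTo)
open import Data.List.Membership.Propositional using (_∈_)
open import Data.List.Membership.Propositional.Properties using (∈-allFin; ∈-upTo⁺)
open import Data.List.Relation.Unary.Any using (here; there)
open import Data.List.Relation.Unary.All.Properties using (All¬⇒¬Any)
open import Data.List.Relation.Unary.Unique.Propositional using (Unique; []; _∷_)
open import Data.Nat.Base using (ℕ)
import Data.Nat.Properties as ℕ
open import Data.Product.Base using (∃; _×_; _,_; proj₁; proj₂)
open import Data.Sum.Base using (_⊎_; inj₁; inj₂)
open import Data.Empty using (⊥-elim)
open import Data.Vec.Functional using () renaming (_∷_ to _◂_)
open import Function.Base using (_∘_; id; case_of_)
open import Function.Bundles using (Equivalence)
open import Function.Definitions using (Congruent; Injective)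
open import Relation.Binary.PropositionalEquality as ≡ using (_≡_; _≢_; _≗_)
open import Relation.Nullary.Decidable using (Dec; yes; no; does; dec-true; dec-false)
open import Relation.Nullary.Negation using (¬_)

private variable
  a : Level
  I J : Set a

module BooleanTests where

  open import Data.Nat.Base using (_+_; _≤_; _<_; _≤ᵇ_; _<ᵇ_)
  open ≡ using (refl; sym; trans; subst)

  bool-ext : ∀ {b c : Bool} → (b ≡ true → c ≡ true) → (c ≡ true → b ≡ true) → b ≡ c
  bool-ext {false} {false} _ _ = refl
  bool-ext {false} {true}  _ c⇒b = c⇒b refl
  bool-ext {true}  {false} b⇒c _ = sym (b⇒c refl)
  bool-ext {true}  {true}  _ _ = refl

  ∧-elim : ∀ {b c} → b ∧ c ≡ true → b ≡ true × c ≡ true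
  ∧-elim {true} {true} _ = refl , refl

  ∧-intro : ∀ {b c} → b ≡ true → c ≡ true → b ∧ c ≡ true
  ∧-intro refl refl = refl

  module _ {k : ℕ} where

    eqᵇ-refl : (i : Fin k) → eqᵇ i i ≡ true
    eqᵇ-refl i = dec-true (i Fin.≟ i) refl

    eqᵇ⇒≡ : {i j : Fin k} → eqᵇ i j ≡ true → i ≡ j
    eqᵇ⇒≡ {i} {j} e with i Fin.≟ j
    ... | yes i≡j = i≡j

    ≢⇒eqᵇ-false : {i j : Fin k} → i ≢ j → eqᵇ i j ≡ false
    ≢⇒eqᵇ-false {i} {j} = dec-false (i Fin.≟ j)

    eqᵇ-false⇒≢ : {i j : Fin k} → eqᵇ i j ≡ false → i ≢ j
    eqᵇ-false⇒≢ {i} e refl with () ← trans (sym e) (eqᵇ-refl i)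

    eqᵇ-sym : (i j : Fin k) → eqᵇ i j ≡ eqᵇ j i
    eqᵇ-sym i j = bool-ext (λ e → subst (λ x → eqᵇ x i ≡ true) (eqᵇ⇒≡ {i} {j} e) (eqᵇ-refl i))
                           (λ e → subst (λ x → eqᵇ x j ≡ true) (eqᵇ⇒≡ {j} {i} e) (eqᵇ-refl j))

  _≗ᵇ_ : ∀ {k n} → (Fin k → Fin n) → (Fin k → Fin n) → Bool
  _≗ᵇ_ {ℕ.zero}  d g = true
  _≗ᵇ_ {ℕ.suc k} d g = eqᵇ (d zero) (g zero) ∧ ((d ∘ suc) ≗ᵇ (g ∘ suc))

  ≗ᵇ⇒≗ : ∀ {k n} {d g : Fin k → Fin n} → d ≗ᵇ g ≡ true → d ≗ g
  ≗ᵇ⇒≗ {ℕ.suc k} e zero    = eqᵇ⇒≡ (proj₁ (∧-elim e))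
  ≗ᵇ⇒≗ {ℕ.suc k} e (suc i) = ≗ᵇ⇒≗ (proj₂ (∧-elim e)) i

  ≗⇒≗ᵇ : ∀ {k n} {d g : Fin k → Fin n} → d ≗ g → d ≗ᵇ g ≡ true
  ≗⇒≗ᵇ {ℕ.zero}  d≗g = refl
  ≗⇒≗ᵇ {ℕ.suc k} {d = d} d≗g =
    ∧-intro (subst (λ x → eqᵇ (d zero) x ≡ true) (d≗g zero) (eqᵇ-refl (d zero))) (≗⇒≗ᵇ (d≗g ∘ suc))

  ≗ᵇ-cong : ∀ {k n} {d d′ g g′ : Fin k → Fin n} → d ≗ d′ → g ≗ g′ → d ≗ᵇ g ≡ d′ ≗ᵇ g′
  ≗ᵇ-cong {ℕ.zero}  _    _    = refl
  ≗ᵇ-cong {ℕ.suc k} d≗d′ g≗g′ =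
    ≡.cong₂ _∧_ (≡.cong₂ eqᵇ (d≗d′ zero) (g≗g′ zero)) (≗ᵇ-cong (d≗d′ ∘ suc) (g≗g′ ∘ suc))

  allᵇ-cong : {p q : I → Bool} (xs : List I) → (∀ x → p x ≡ q x) → allᵇ p xs ≡ allᵇ q xs
  allᵇ-cong []       _   = refl
  allᵇ-cong (x ∷ xs) p≡q = ≡.cong₂ _∧_ (p≡q x) (allᵇ-cong xs p≡q)

  allᵇ⁻ : (p : I → Bool) {xs : List I} → allᵇ p xs ≡ true → ∀ {x} → x ∈ xs → p x ≡ true
  allᵇ⁻ p {_ ∷ _} e (here refl)  = proj₁ (∧-elim e)
  allᵇ⁻ p {_ ∷ _} e (there x∈xs) = allᵇ⁻ p (proj₂ (∧-elim e)) x∈xs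

  allᵇ⁺ : (p : I → Bool) (xs : List I) → (∀ {x} → x ∈ xs → p x ≡ true) → allᵇ p xs ≡ true
  allᵇ⁺ p []       _   = refl
  allᵇ⁺ p (_ ∷ xs) all = ∧-intro (all (here refl)) (allᵇ⁺ p xs (all ∘ there))

  record IsLeastFrom (p : ℕ → Bool) (a r : ℕ) : Set where
    field
      from  : a ≤ r
      hit   : p r ≡ true
      below : ∀ m → a ≤ m → m < r → p m ≡ false

  firstHit-least : (p : ℕ → Bool) (G : List ℕ → ℕ) → (∀ m ms → G (m ∷ ms) ≡ (if p m then m else G ms)) →
                   ∀ j a (f : ℕ → ℕ) → (∀ t → f t ≡ a + t) → (∃ λ m → a ≤ m × m < a + j × p m ≡ true) →
                   IsLeastFrom p a (G (applyUpTo f j))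
  firstHit-least p G G-step ℕ.zero a f f≡a+ (m , a≤m , m<a+0 , _) =
    ⊥-elim (ℕ.<⇒≱ (subst (m <_) (ℕ.+-identityʳ a) m<a+0) a≤m)
  firstHit-least p G G-step (ℕ.suc j) a f f≡a+ (m , a≤m , m<a+1+j , pm)
    rewrite G-step (f 0) (applyUpTo (f ∘ ℕ.suc) j) | f≡a+ 0 | ℕ.+-identityʳ a
    with p a in pa
  ... | true  = record { from = ℕ.≤-refl ; hit = pa ; below = λ m a≤m m<a → ⊥-elim (ℕ.<⇒≱ m<a a≤m) }
  ... | false with ℕ.m≤n⇒m<n∨m≡n a≤m
  ...   | inj₂ refl with () ← trans (sym pa) pm
  ...   | inj₁ a<m = record
    { from  = ℕ.≤-trans (ℕ.n≤1+n a) (IsLeastFrom.from rest)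
    ; hit   = IsLeastFrom.hit rest
    ; below = below
    }
    where
    rest = firstHit-least p G G-step j (ℕ.suc a) (f ∘ ℕ.suc) (λ t → trans (f≡a+ (ℕ.suc t)) (ℕ.+-suc a t))
             (m , a<m , subst (m <_) (ℕ.+-suc a j) m<a+1+j , pm)
    below : ∀ m′ → a ≤ m′ → m′ < G (applyUpTo (f ∘ ℕ.suc) j) → p m′ ≡ false
    below m′ a≤m′ m′<r with ℕ.m≤n⇒m<n∨m≡n a≤m′
    ... | inj₂ refl = pa
    ... | inj₁ a<m′ = IsLeastFrom.below rest m′ a<m′ m′<r

  ≤ᵇ⇒≤ : ∀ {m n} → (m ≤ᵇ n) ≡ true → m ≤ n
  ≤ᵇ⇒≤ {m} {n} e = ℕ.≤ᵇ⇒≤ m n (subst T (sym e) _)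

  ≤⇒≤ᵇ : ∀ {m n} → m ≤ n → (m ≤ᵇ n) ≡ true
  ≤⇒≤ᵇ m≤n = Equivalence.to Bool.T-≡ (ℕ.≤⇒≤ᵇ m≤n)

  <ᵇ⇒< : ∀ {m n} → (m <ᵇ n) ≡ true → m < n
  <ᵇ⇒< {m} {n} e = ℕ.<ᵇ⇒< m n (subst T (sym e) _)

  <⇒<ᵇ : ∀ {m n} → m < n → (m <ᵇ n) ≡ true
  <⇒<ᵇ m<n = Equivalence.to Bool.T-≡ (ℕ.<⇒<ᵇ m<n)

  ≮⇒<ᵇ-false : ∀ {m n} → ¬ m < n → (m <ᵇ n) ≡ false
  ≮⇒<ᵇ-false {m} {n} m≮n with m <ᵇ n in e
  ... | true  = ⊥-elim (m≮n (<ᵇ⇒< e))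
  ... | false = refl

  private
    injectivityTest : ∀ {k} → (Fin k → Fin k) → Fin k → Fin k → Bool
    injectivityTest σ i j = not (eqᵇ (σ i) (σ j)) ∨ eqᵇ i j

  isInjectiveᵇ⇒Injective : ∀ {k} {σ : Fin k → Fin k} → isInjectiveᵇ σ ≡ true → Injective _≡_ _≡_ σ
  isInjectiveᵇ⇒Injective {k} {σ} e {i} {j} σi≡σj
    with allᵇ⁻ (injectivityTest σ i)
                (allᵇ⁻ (λ i → allᵇ (injectivityTest σ i) (allFin k)) e (∈-allFin i)) (∈-allFin j)
  ... | test rewrite dec-true (σ i Fin.≟ σ j) σi≡σj = eqᵇ⇒≡ test

  Injective⇒isInjectiveᵇ : ∀ {k} {σ : Fin k → Fin k} → Injective _≡_ _≡_ σ → isInjectiveᵇ σ ≡ true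
  Injective⇒isInjectiveᵇ {k} {σ} σ-inj =
    allᵇ⁺ _ (allFin k) λ {i} _ → allᵇ⁺ _ (allFin k) λ {j} _ → test i j
    where
    test : ∀ i j → injectivityTest σ i j ≡ true
    test i j with σ i Fin.≟ σ j
    ... | yes σi≡σj = subst (λ x → eqᵇ x j ≡ true) (sym (σ-inj σi≡σj)) (eqᵇ-refl j)
    ... | no _      = refl

open BooleanTests

record SubsetBijection {k n k′ n′ : ℕ}
    (Z : (Fin k → Fin n) → Bool) (Y : (Fin k′ → Fin n′) → Bool) : Set where
  field
    to        : (Fin k → Fin n) → (Fin k′ → Fin n′)
    from      : (Fin k′ → Fin n′) → (Fin k → Fin n)
    Z-cong    : Congruent _≗_ _≡_ Z
    Y-cong    : Congruent _≗_ _≡_ Y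
    to-cong   : Congruent _≗_ _≗_ to
    from-cong : Congruent _≗_ _≗_ from
    to-Y      : ∀ d → Z d ≡ true → Y (to d) ≡ true
    from-Z    : ∀ c → Y c ≡ true → Z (from c) ≡ true
    from∘to   : ∀ d → Z d ≡ true → from (to d) ≗ d
    to∘from   : ∀ c → Y c ≡ true → to (from c) ≗ c

  fibre-on : ∀ c → Y c ≡ true → ∀ d → (Z d ∧ c ≗ᵇ to d) ≡ d ≗ᵇ from c
  fibre-on c Yc d = bool-ext
    (λ e → let Zd , c≗tod = ∧-elim e in ≗⇒≗ᵇ λ i →
      ≡.trans (≡.sym (from∘to d Zd i)) (from-cong (λ j → ≡.sym (≗ᵇ⇒≗ c≗tod j)) i))
    (λ e → let d≗fromc = ≗ᵇ⇒≗ e in ∧-intro (≡.trans (Z-cong d≗fromc) (from-Z c Yc))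
      (≗⇒≗ᵇ λ i → ≡.trans (≡.sym (to∘from c Yc i)) (to-cong (λ j → ≡.sym (d≗fromc j)) i)))

  fibre-off : ∀ c → Y c ≡ false → ∀ d → (Z d ∧ c ≗ᵇ to d) ≡ false
  fibre-off c Yc d with Z d ∧ c ≗ᵇ to d in e
  ... | false = ≡.refl
  ... | true  = let Zd , c≗tod = ∧-elim e in
                ≡.trans (≡.sym (≡.trans (Y-cong (≗ᵇ⇒≗ c≗tod)) (to-Y d Zd))) Yc

module Cycles {k : ℕ} (σ : Fin k → Fin k) (σ-injective : Injective _≡_ _≡_ σ) where

  open import Data.Nat.Base using (pred; >-nonZero; _+_; _∸_; _≤_; _<_; s≤s; z≤n)
  open ≡ using (refl; sym; trans; cong; subst)
  open import Data.List.Extrema.Nat using (argmin; argmin-sel; f[argmin]≤f[xs])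
  open import Data.List.Membership.Propositional.Properties using (∈-applyUpTo⁺; ∈-applyUpTo⁻)
  open import Data.List.Relation.Unary.All using (lookup)
  open import Data.List.Relation.Unary.Unique.Propositional.Properties using (applyUpTo⁺₁)

  iter-+ : ∀ m n i → iter σ (m + n) i ≡ iter σ m (iter σ n i)
  iter-+ ℕ.zero    n i = refl
  iter-+ (ℕ.suc m) n i = cong σ (iter-+ m n i)

  iter-injective : ∀ m → Injective _≡_ _≡_ (iter σ m)
  iter-injective ℕ.zero    e = e
  iter-injective (ℕ.suc m) e = iter-injective m (σ-injective e)

  iter-collision : ∀ i {a b} → a < b → iter σ a i ≡ iter σ b i → ∃ λ d → 1 ≤ d × d ≤ b × iter σ d i ≡ i
  iter-collision i {a} {b} a<b σᵃi≡σᵇi with o , 1+a+o≡b ← ℕ.m≤n⇒∃[o]m+o≡n a<b =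
    ℕ.suc o , s≤s z≤n , ℕ.≤-trans (ℕ.m≤n+m (ℕ.suc o) a) (ℕ.≤-reflexive a+1+o≡b) ,
    sym (iter-injective a (begin
      iter σ a i                     ≡⟨ σᵃi≡σᵇi ⟩
      iter σ b i                     ≡⟨ cong (λ t → iter σ t i) (sym a+1+o≡b) ⟩
      iter σ (a + ℕ.suc o) i         ≡⟨ iter-+ a (ℕ.suc o) i ⟩
      iter σ a (iter σ (ℕ.suc o) i)  ∎))
    where
    open ≡.≡-Reasoning
    a+1+o≡b : a + ℕ.suc o ≡ b
    a+1+o≡b = trans (ℕ.+-suc a o) 1+a+o≡b

  iter-returns : ∀ i → ∃ λ d → 1 ≤ d × d ≤ k × iter σ d i ≡ i
  iter-returns i
    with a , b , a<b , σᵃi≡σᵇi ← Fin.pigeonhole (ℕ.n<1+n k) (λ (j : Fin (ℕ.suc k)) → iter σ (toℕ j) i)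
    with d , 1≤d , d≤b , σᵈi≡i ← iter-collision i a<b σᵃi≡σᵇi =
    d , 1≤d , ℕ.≤-trans d≤b (ℕ.≤-pred (Fin.toℕ<n b)) , σᵈi≡i

  private
    cycleLen-search : ∀ i {G : List ℕ → ℕ} → (∀ m ms → G (m ∷ ms) ≡ (if eqᵇ (iter σ m i) i then m else G ms)) →
               ∀ xs → xs ≡ applyUpTo ℕ.suc k → IsLeastFrom (λ m → eqᵇ (iter σ m i) i) 1 (G xs)
    cycleLen-search i G-step _ refl with d , 1≤d , d≤k , σᵈi≡i ← iter-returns i =
      firstHit-least _ _ G-step k 1 ℕ.suc (λ _ → refl) (d , 1≤d , s≤s d≤k , dec-true (_ Fin.≟ i) σᵈi≡i)

  -- cycleLen searches [1..k] with a function local to its definition; the G of cycleLen-search is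
  -- solved to that function before the list is abstracted.
  cycleLen-least : ∀ i → IsLeastFrom (λ m → eqᵇ (iter σ m i) i) 1 (cycleLen σ i)
  cycleLen-least i with map ℕ.suc (upTo k) | map-applyUpTo id ℕ.suc k | cycleLen-search i (λ _ _ → refl)
  ... | xs | xs≡1…k | least = least xs xs≡1…k

  cycleLen-pos : ∀ i → 1 ≤ cycleLen σ i
  cycleLen-pos i = IsLeastFrom.from (cycleLen-least i)

  iter-cycleLen : ∀ i → iter σ (cycleLen σ i) i ≡ i
  iter-cycleLen i = eqᵇ⇒≡ (IsLeastFrom.hit (cycleLen-least i))

  iter-mod : ∀ m i → ∃ λ r → r < cycleLen σ i × iter σ m i ≡ iter σ r i
  iter-mod ℕ.zero    i = 0 , cycleLen-pos i , refl
  iter-mod (ℕ.suc m) i with r , r<L , σᵐi≡σʳi ← iter-mod m i with ℕ.m≤n⇒m<n∨m≡n r<L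
  ... | inj₁ 1+r<L = ℕ.suc r , 1+r<L , cong σ σᵐi≡σʳi
  ... | inj₂ 1+r≡L = 0 , cycleLen-pos i ,
    trans (cong σ σᵐi≡σʳi) (trans (cong (λ t → iter σ t i) 1+r≡L) (iter-cycleLen i))

  iter-distinct : ∀ i {a b} → a < b → b < cycleLen σ i → iter σ a i ≢ iter σ b i
  iter-distinct i a<b b<L σᵃi≡σᵇi with d , 1≤d , d≤b , σᵈi≡i ← iter-collision i a<b σᵃi≡σᵇi =
    eqᵇ-false⇒≢ (IsLeastFrom.below (cycleLen-least i) d 1≤d (ℕ.≤-<-trans d≤b b<L)) σᵈi≡i

  orbit : Fin k → List (Fin k)
  orbit i = applyUpTo (λ m → iter σ m i) (cycleLen σ i)

  orbit-Unique : ∀ i → Unique (orbit i)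
  orbit-Unique i = applyUpTo⁺₁ _ (cycleLen σ i) (iter-distinct i)

  iter∈orbit : ∀ m i → iter σ m i ∈ orbit i
  iter∈orbit m i with r , r<L , σᵐi≡σʳi ← iter-mod m i =
    subst (_∈ orbit i) (sym σᵐi≡σʳi) (∈-applyUpTo⁺ _ r<L)

  ∈orbit⇒iter : ∀ {i r} → r ∈ orbit i → ∃ λ m → iter σ m i ≡ r
  ∈orbit⇒iter r∈ with m , _ , r≡σᵐi ← ∈-applyUpTo⁻ _ r∈ = m , sym r≡σᵐi

  orbit-sym : ∀ {i r} → r ∈ orbit i → i ∈ orbit r
  orbit-sym {i} {r} r∈ with m , m<L , refl ← ∈-applyUpTo⁻ _ r∈ =
    subst (_∈ orbit r) σᴸi≡i (iter∈orbit (cycleLen σ i ∸ m) r)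
    where
    σᴸi≡i : iter σ (cycleLen σ i ∸ m) (iter σ m i) ≡ i
    σᴸi≡i = trans (sym (iter-+ (cycleLen σ i ∸ m) m i))
                  (trans (cong (λ t → iter σ t i) (ℕ.m∸n+n≡m (ℕ.<⇒≤ m<L))) (iter-cycleLen i))

  orbit-trans : ∀ {i r s} → r ∈ orbit i → s ∈ orbit r → s ∈ orbit i
  orbit-trans {i} r∈ s∈ with m , _ , refl ← ∈-applyUpTo⁻ _ r∈ | m′ , _ , refl ← ∈-applyUpTo⁻ _ s∈ =
    subst (_∈ orbit i) (iter-+ m′ m i) (iter∈orbit (m′ + m) i)

  lead : Fin k → Fin k
  lead r = argmin toℕ r (orbit r)

  lead∈orbit : ∀ r → lead r ∈ orbit r
  lead∈orbit r with argmin-sel toℕ r (orbit r)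
  ... | inj₁ lead≡r = subst (_∈ orbit r) (sym lead≡r) (iter∈orbit 0 r)
  ... | inj₂ lead∈  = lead∈

  lead-≤ : ∀ {r s} → s ∈ orbit r → toℕ (lead r) ≤ toℕ s
  lead-≤ {r} = lookup (f[argmin]≤f[xs] r (orbit r))

  lead-unique : ∀ {r x} → x ∈ orbit r → (∀ {s} → s ∈ orbit r → toℕ x ≤ toℕ s) → lead r ≡ x
  lead-unique {r} x∈ x-min = Fin.toℕ-injective (ℕ.≤-antisym (lead-≤ x∈) (x-min (lead∈orbit r)))

  lead-cong : ∀ {r r′} → r′ ∈ orbit r → lead r′ ≡ lead r
  lead-cong {r} r′∈ = lead-unique (orbit-trans (orbit-sym r′∈) (lead∈orbit r)) (lead-≤ ∘ orbit-trans r′∈)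

  isLeader⇒lead≡ : ∀ {i} → isLeader σ i ≡ true → lead i ≡ i
  isLeader⇒lead≡ {i} leader = lead-unique (iter∈orbit 0 i) λ s∈ → below s∈
    where
    below : ∀ {s} → s ∈ orbit i → toℕ i ≤ toℕ s
    below s∈ with m , m<L , refl ← ∈-applyUpTo⁻ _ s∈ = ≤ᵇ⇒≤ (allᵇ⁻ _ leader (∈-upTo⁺ m<L))

  lead≡⇒isLeader : ∀ {i} → lead i ≡ i → isLeader σ i ≡ true
  lead≡⇒isLeader {i} lead≡i = allᵇ⁺ _ (upTo (cycleLen σ i)) λ {m} _ →
    ≤⇒≤ᵇ (subst (λ x → toℕ x ≤ toℕ (iter σ m i)) lead≡i (lead-≤ (iter∈orbit m i)))

  lead-isLeader : ∀ r → isLeader σ (lead r) ≡ true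
  lead-isLeader r = lead≡⇒isLeader (lead-cong (lead∈orbit r))

  lead-σ : ∀ r → lead (σ r) ≡ lead r
  lead-σ r = lead-cong (iter∈orbit 1 r)

  ∈orbit⇔lead≡ : ∀ {i r} → isLeader σ i ≡ true → (r ∈ orbit i → lead r ≡ i) × (lead r ≡ i → r ∈ orbit i)
  ∈orbit⇔lead≡ {i} {r} leader =
    (λ r∈ → trans (lead-cong r∈) (isLeader⇒lead≡ leader)) ,
    (λ lead≡i → orbit-sym (subst (_∈ orbit r) lead≡i (lead∈orbit r)))

  σ⁻¹ : Fin k → Fin k
  σ⁻¹ x = iter σ (pred (cycleLen σ x)) x

  σ∘σ⁻¹ : ∀ x → σ (σ⁻¹ x) ≡ x
  σ∘σ⁻¹ x = trans (cong (λ t → iter σ t x) (ℕ.suc-pred (cycleLen σ x) ⦃ >-nonZero (cycleLen-pos x) ⦄))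
                  (iter-cycleLen x)

module Transpositions {k : ℕ} where

  open ≡ using (refl; sym; trans; cong)
  open import Data.Fin.Permutation.Components using (transpose)

  transpose-matchˡ : (p q : Fin k) → transpose p q p ≡ q
  transpose-matchˡ p q rewrite dec-true (p Fin.≟ p) refl = refl

  transpose-matchʳ : (p q : Fin k) → transpose p q q ≡ p
  transpose-matchʳ p q with q Fin.≟ p
  ... | yes q≡p = q≡p
  ... | no  _   rewrite dec-true (q Fin.≟ q) refl = refl

  transpose-other : ∀ {p q r : Fin k} → r ≢ p → r ≢ q → transpose p q r ≡ r
  transpose-other {p} {q} {r} r≢p r≢q rewrite dec-false (r Fin.≟ p) r≢p | dec-false (r Fin.≟ q) r≢q = refl

  transpose-involutive : (p q r : Fin k) → transpose p q (transpose p q r) ≡ r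
  transpose-involutive p q r = by-cases (r Fin.≟ p) (r Fin.≟ q)
    where
    by-cases : Dec (r ≡ p) → Dec (r ≡ q) → transpose p q (transpose p q r) ≡ r
    by-cases (yes refl) _ = trans (cong (transpose p q) (transpose-matchˡ p q)) (transpose-matchʳ p q)
    by-cases (no _) (yes refl) = trans (cong (transpose p q) (transpose-matchʳ p q)) (transpose-matchˡ p q)
    by-cases (no r≢p) (no r≢q) = trans (cong (transpose p q) (transpose-other r≢p r≢q)) (transpose-other r≢p r≢q)

  transpose-invariant : {A : Set a} (c : Fin k → A) {p q : Fin k} → c p ≡ c q → c ∘ transpose p q ≗ c
  transpose-invariant c {p} {q} cp≡cq r = by-cases (r Fin.≟ p) (r Fin.≟ q)
    where
    by-cases : Dec (r ≡ p) → Dec (r ≡ q) → c (transpose p q r) ≡ c r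
    by-cases (yes refl) _          = trans (cong c (transpose-matchˡ p q)) (sym cp≡cq)
    by-cases (no _)     (yes refl) = trans (cong c (transpose-matchʳ p q)) cp≡cq
    by-cases (no r≢p)   (no r≢q)   = cong c (transpose-other r≢p r≢q)

  involutive⇒injective : {π : Fin k → Fin k} → (∀ r → π (π r) ≡ r) → Injective _≡_ _≡_ π
  involutive⇒injective {π} π²≡id {x} {y} πx≡πy = trans (sym (π²≡id x)) (trans (cong π πx≡πy) (π²≡id y))

  transpose-injective : (p q : Fin k) → Injective _≡_ _≡_ (transpose p q)
  transpose-injective p q = involutive⇒injective (transpose-involutive p q)

  transpose-conjugate : (π : Fin k → Fin k) → (∀ r → π (π r) ≡ r) →
                        ∀ p q r → π (transpose p q (π r)) ≡ transpose (π p) (π q) r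
  transpose-conjugate π π²≡id p q r = by-cases (π r Fin.≟ p) (π r Fin.≟ q)
    where
    open ≡.≡-Reasoning
    by-cases : Dec (π r ≡ p) → Dec (π r ≡ q) → π (transpose p q (π r)) ≡ transpose (π p) (π q) r
    by-cases (yes refl) _ = begin
      π (transpose (π r) q (π r))         ≡⟨ cong π (transpose-matchˡ (π r) q) ⟩
      π q                                 ≡⟨ sym (transpose-matchˡ (π (π r)) (π q)) ⟩
      transpose (π (π r)) (π q) (π (π r)) ≡⟨ cong (transpose (π (π r)) (π q)) (π²≡id r) ⟩
      transpose (π (π r)) (π q) r         ∎
    by-cases (no _) (yes refl) = begin
      π (transpose p (π r) (π r))         ≡⟨ cong π (transpose-matchʳ p (π r)) ⟩
      π p                                 ≡⟨ sym (transpose-matchʳ (π p) (π (π r))) ⟩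
      transpose (π p) (π (π r)) (π (π r)) ≡⟨ cong (transpose (π p) (π (π r))) (π²≡id r) ⟩
      transpose (π p) (π (π r)) r         ∎
    by-cases (no πr≢p) (no πr≢q) = trans (cong π (transpose-other πr≢p πr≢q)) (trans (π²≡id r)
      (sym (transpose-other (λ r≡πp → πr≢p (trans (cong π r≡πp) (π²≡id p)))
                            (λ r≡πq → πr≢q (trans (cong π r≡πq) (π²≡id q))))))

module Stabilisers where

  open ≡ using (refl; sym; trans; cong; cong₂)
  open Transpositions
  open import Data.Fin.Permutation.Components using (transpose)

  stabilises : ∀ {k n} → (Fin k → Fin n) → (Fin k → Fin k) → Bool
  stabilises c σ = isInjectiveᵇ σ ∧ (c ∘ σ) ≗ᵇ c

  isInjectiveᵇ-cong : ∀ {k} → Congruent _≗_ _≡_ (isInjectiveᵇ {k})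
  isInjectiveᵇ-cong {x = σ} {τ} σ≗τ = bool-ext
    (λ e → Injective⇒isInjectiveᵇ λ τx≡τy →
      isInjectiveᵇ⇒Injective e (trans (σ≗τ _) (trans τx≡τy (sym (σ≗τ _)))))
    (λ e → Injective⇒isInjectiveᵇ λ σx≡σy →
      isInjectiveᵇ⇒Injective e (trans (sym (σ≗τ _)) (trans σx≡σy (σ≗τ _))))

  stabilises-cong : ∀ {k n} (c : Fin k → Fin n) → Congruent _≗_ _≡_ (stabilises c)
  stabilises-cong c σ≗σ′ = cong₂ _∧_ (isInjectiveᵇ-cong σ≗σ′) (≗ᵇ-cong (cong c ∘ σ≗σ′) (λ _ → refl))

  module _ {k n} (c : Fin k → Fin n) {p q : Fin k} (cp≡cq : c p ≡ c q) where

    transpose∘-stabilises : ∀ σ → stabilises c σ ≡ true → stabilises c (transpose p q ∘ σ) ≡ true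
    transpose∘-stabilises σ e with inj , fixes ← ∧-elim e = ∧-intro
      (Injective⇒isInjectiveᵇ {σ = transpose p q ∘ σ} (isInjectiveᵇ⇒Injective {σ = σ} inj ∘ transpose-injective p q))
      (≗⇒≗ᵇ λ r → trans (transpose-invariant c cp≡cq (σ r)) (≗ᵇ⇒≗ fixes r))

    transpose∘-involution : SubsetBijection (stabilises c) (stabilises c)
    transpose∘-involution = record
      { to        = transpose p q ∘_
      ; from      = transpose p q ∘_
      ; Z-cong    = stabilises-cong c
      ; Y-cong    = stabilises-cong c
      ; to-cong   = λ σ≗σ′ → cong (transpose p q) ∘ σ≗σ′
      ; from-cong = λ σ≗σ′ → cong (transpose p q) ∘ σ≗σ′
      ; to-Y      = transpose∘-stabilises
      ; from-Z    = transpose∘-stabilises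
      ; from∘to   = λ σ _ r → transpose-involutive p q (σ r)
      ; to∘from   = λ σ _ r → transpose-involutive p q (σ r)
      }

module _ {k : ℕ} where
  open import Data.List.Membership.DecPropositional (Fin._≟_ {k}) public using (_∈?_)

module BigOperators {c ℓ} (M : CommutativeMonoid c ℓ) where

  open CommutativeMonoid M
  open import Algebra.Properties.CommutativeSemigroup commutativeSemigroup using (interchange)
  open import Relation.Binary.Reasoning.Setoid setoid

  ⨁ : List I → (I → Carrier) → Carrier
  ⨁ xs g = foldr _∙_ ε (map g xs)

  if-cong : ∀ b {x y} → x ≈ y → (if b then x else ε) ≈ (if b then y else ε)
  if-cong true  x≈y = x≈y
  if-cong false _   = refl

  if-congᵇ : ∀ {b b′ x y} → b ≡ b′ → x ≈ y → (if b then x else ε) ≈ (if b′ then y else ε)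
  if-congᵇ {b} ≡.refl = if-cong b

  if-split : ∀ a b x → (if a then x else ε) ≈ (if a ∧ b then x else ε) ∙ (if a ∧ not b then x else ε)
  if-split true  true  x = sym (identityʳ x)
  if-split true  false x = sym (identityˡ x)
  if-split false _     x = sym (identityˡ ε)

  ⨁-cong : (xs : List I) {g h : I → Carrier} → (∀ x → g x ≈ h x) → ⨁ xs g ≈ ⨁ xs h
  ⨁-cong []       _   = refl
  ⨁-cong (x ∷ xs) g≈h = ∙-cong (g≈h x) (⨁-cong xs g≈h)

  ⨁-ε : (xs : List I) → ⨁ xs (λ _ → ε) ≈ ε
  ⨁-ε []       = refl
  ⨁-ε (x ∷ xs) = trans (identityˡ _) (⨁-ε xs)

  ⨁-++ : (xs ys : List I) (g : I → Carrier) → ⨁ (xs ++ ys) g ≈ ⨁ xs g ∙ ⨁ ys g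
  ⨁-++ []       ys g = sym (identityˡ _)
  ⨁-++ (x ∷ xs) ys g = trans (∙-congˡ (⨁-++ xs ys g)) (sym (assoc _ _ _))

  ⨁-map : (f : I → J) (xs : List I) (g : J → Carrier) → ⨁ (map f xs) g ≡ ⨁ xs (g ∘ f)
  ⨁-map f xs g = ≡.cong (foldr _∙_ ε) (≡.sym (map-∘ xs))

  ⨁-concatMap : (f : I → List J) (xs : List I) (g : J → Carrier) →
                ⨁ (concatMap f xs) g ≈ ⨁ xs (λ x → ⨁ (f x) g)
  ⨁-concatMap f []       g = refl
  ⨁-concatMap f (x ∷ xs) g = trans (⨁-++ (f x) (concatMap f xs) g) (∙-congˡ (⨁-concatMap f xs g))

  ⨁-distrib : (xs : List I) (g h : I → Carrier) → ⨁ xs (λ x → g x ∙ h x) ≈ ⨁ xs g ∙ ⨁ xs h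
  ⨁-distrib []       g h = sym (identityˡ ε)
  ⨁-distrib (x ∷ xs) g h = trans (∙-congˡ (⨁-distrib xs g h)) (interchange _ _ _ _)

  ⨁-comm : (xs : List I) (ys : List J) (g : I → J → Carrier) →
           ⨁ xs (λ x → ⨁ ys (g x)) ≈ ⨁ ys (λ y → ⨁ xs (λ x → g x y))
  ⨁-comm []       ys g = sym (⨁-ε ys)
  ⨁-comm (x ∷ xs) ys g = trans (∙-congˡ (⨁-comm xs ys g)) (sym (⨁-distrib ys (g x) _))

  ⨁-filter : (p : I → Bool) (xs : List I) (g : I → Carrier) →
             ⨁ (filterᵇ p xs) g ≈ ⨁ xs (λ x → if p x then g x else ε)
  ⨁-filter p []       g = refl
  ⨁-filter p (x ∷ xs) g with p x
  ... | true  = ∙-congˡ (⨁-filter p xs g)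
  ... | false = trans (⨁-filter p xs g) (sym (identityˡ _))

  ⨁-cartesianProduct : (xs : List I) (ys : List J) (g : I × J → Carrier) →
                       ⨁ (cartesianProduct xs ys) g ≈ ⨁ xs (λ x → ⨁ ys (λ y → g (x , y)))
  ⨁-cartesianProduct []       ys g = refl
  ⨁-cartesianProduct (x ∷ xs) ys g = trans (⨁-++ (map (x ,_) ys) (cartesianProduct xs ys) g)
    (∙-cong (reflexive (⨁-map (x ,_) ys g)) (⨁-cartesianProduct xs ys g))

  ⨁-allFin-suc : ∀ k (g : Fin (ℕ.suc k) → Carrier) → ⨁ (allFin (ℕ.suc k)) g ≡ g zero ∙ ⨁ (allFin k) (g ∘ suc)
  ⨁-allFin-suc k g = ≡.cong (λ l → g zero ∙ foldr _∙_ ε l)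
    (≡.trans (map-tabulate suc g) (≡.sym (map-tabulate id (g ∘ suc))))

  ⨁-allFin-0 : ∀ {k} → k ≡ 0 → (g : Fin k → Carrier) → ⨁ (allFin k) g ≈ ε
  ⨁-allFin-0 ≡.refl g = refl

  ⨁-allFin-δ : ∀ {k} (x : Fin k) (g : Fin k → Carrier) → ⨁ (allFin k) (λ r → if eqᵇ r x then g r else ε) ≈ g x
  ⨁-allFin-δ {ℕ.suc k} zero g = begin
    ⨁ (allFin (ℕ.suc k)) (λ r → if eqᵇ r zero then g r else ε) ≡⟨ ⨁-allFin-suc k _ ⟩
    g zero ∙ ⨁ (allFin k) (λ _ → ε)                              ≈⟨ ∙-congˡ (⨁-ε (allFin k)) ⟩
    g zero ∙ ε                                                   ≈⟨ identityʳ _ ⟩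
    g zero                                                       ∎
  ⨁-allFin-δ {ℕ.suc k} (suc x) g = begin
    ⨁ (allFin (ℕ.suc k)) (λ r → if eqᵇ r (suc x) then g r else ε) ≡⟨ ⨁-allFin-suc k _ ⟩
    ε ∙ ⨁ (allFin k) (λ r → if eqᵇ r x then g (suc r) else ε)     ≈⟨ identityˡ _ ⟩
    ⨁ (allFin k) (λ r → if eqᵇ r x then g (suc r) else ε)         ≈⟨ ⨁-allFin-δ x (g ∘ suc) ⟩
    g (suc x)                                                     ∎

  ⨁-permute : ∀ {k} {σ : Fin k → Fin k} → Injective _≡_ _≡_ σ → (g : Fin k → Carrier) →
              ⨁ (allFin k) (g ∘ σ) ≈ ⨁ (allFin k) g
  ⨁-permute {k} {σ} σ-injective g = sym (begin
    ⨁ (allFin k) g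
      ≈⟨ ⨁-cong (allFin k) (λ x → trans (⨁-allFin-δ (σ⁻¹ x) (g ∘ σ)) (reflexive (≡.cong g (σ∘σ⁻¹ x)))) ⟨
    ⨁ (allFin k) (λ x → ⨁ (allFin k) (λ i → if eqᵇ i (σ⁻¹ x) then g (σ i) else ε))
      ≈⟨ ⨁-comm (allFin k) (allFin k) _ ⟩
    ⨁ (allFin k) (λ i → ⨁ (allFin k) (λ x → if eqᵇ i (σ⁻¹ x) then g (σ i) else ε))
      ≈⟨ ⨁-cong (allFin k) (λ i → ⨁-cong (allFin k) (λ x → if-congᵇ (preimage i x) refl)) ⟩
    ⨁ (allFin k) (λ i → ⨁ (allFin k) (λ x → if eqᵇ x (σ i) then g (σ i) else ε))
      ≈⟨ ⨁-cong (allFin k) (λ i → ⨁-allFin-δ (σ i) (λ _ → g (σ i))) ⟩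
    ⨁ (allFin k) (g ∘ σ) ∎)
    where
    open Cycles σ σ-injective using (σ⁻¹; σ∘σ⁻¹)
    preimage : ∀ i x → eqᵇ i (σ⁻¹ x) ≡ eqᵇ x (σ i)
    preimage i x = bool-ext
      (λ e → ≡.subst (λ y → eqᵇ x y ≡ true)
               (≡.trans (≡.sym (σ∘σ⁻¹ x)) (≡.cong σ (≡.sym (eqᵇ⇒≡ {i = i} e)))) (eqᵇ-refl x))
      (λ e → ≡.subst (λ y → eqᵇ i y ≡ true)
               (σ-injective (≡.trans (≡.sym (eqᵇ⇒≡ {i = x} e)) (≡.sym (σ∘σ⁻¹ x)))) (eqᵇ-refl i))

  ⨁-Unique : ∀ {k} {xs : List (Fin k)} → Unique xs → (g : Fin k → Carrier) →
             ⨁ xs g ≈ ⨁ (allFin k) (λ r → if does (r ∈? xs) then g r else ε)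
  ⨁-Unique {k} {[]}     []            g = sym (⨁-ε (allFin k))
  ⨁-Unique {k} {x ∷ xs} (x∉xs ∷ uxs) g = begin
    g x ∙ ⨁ xs g
      ≈⟨ ∙-cong (sym (⨁-allFin-δ x g)) (⨁-Unique uxs g) ⟩
    ⨁ (allFin k) (λ r → if eqᵇ r x then g r else ε) ∙ ⨁ (allFin k) (λ r → if does (r ∈? xs) then g r else ε)
      ≈⟨ ⨁-distrib (allFin k) _ _ ⟨
    ⨁ (allFin k) (λ r → (if eqᵇ r x then g r else ε) ∙ (if does (r ∈? xs) then g r else ε))
      ≈⟨ ⨁-cong (allFin k) split ⟨
    ⨁ (allFin k) (λ r → if does (r ∈? x ∷ xs) then g r else ε) ∎
    where
    split : ∀ r → (if eqᵇ r x ∨ does (r ∈? xs) then g r else ε) ≈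
                  (if eqᵇ r x then g r else ε) ∙ (if does (r ∈? xs) then g r else ε)
    split r with r Fin.≟ x
    ... | yes ≡.refl rewrite dec-false (r ∈? xs) (All¬⇒¬Any x∉xs) = sym (identityʳ (g r))
    ... | no _ = sym (identityˡ _)

  ⨁-allFuns-suc : ∀ {k n} (F : (Fin (ℕ.suc k) → Fin n) → Carrier) → Congruent _≗_ _≈_ F →
                  ⨁ (allFuns (ℕ.suc k) n) F ≈ ⨁ (allFin n) (λ x → ⨁ (allFuns k n) (λ d → F (x ◂ d)))
  ⨁-allFuns-suc {k} {n} F F-cong = trans (⨁-concatMap _ (allFin n) F) (⨁-cong (allFin n) λ x →
    trans (reflexive (⨁-map _ (allFuns k n) F))
          (⨁-cong (allFuns k n) λ d → F-cong λ { zero → ≡.refl ; (suc i) → ≡.refl }))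

  ⨁-allFuns-δ : ∀ {k n} (g : Fin k → Fin n) (X : (Fin k → Fin n) → Carrier) → Congruent _≗_ _≈_ X →
                ⨁ (allFuns k n) (λ d → if d ≗ᵇ g then X d else ε) ≈ X g
  ⨁-allFuns-δ {ℕ.zero}    g X X-cong = trans (identityʳ _) (X-cong λ ())
  ⨁-allFuns-δ {ℕ.suc k} {n} g X X-cong = begin
    ⨁ (allFuns (ℕ.suc k) n) (λ d → if d ≗ᵇ g then X d else ε)
      ≈⟨ ⨁-allFuns-suc _ (λ d≗d′ → if-congᵇ (≗ᵇ-cong {g = g} d≗d′ (λ _ → ≡.refl)) (X-cong d≗d′)) ⟩
    ⨁ (allFin n) (λ x → ⨁ (allFuns k n) (λ d → if eqᵇ x (g zero) ∧ d ≗ᵇ (g ∘ suc) then X (x ◂ d) else ε))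
      ≈⟨ ⨁-cong (allFin n) fix-head ⟩
    ⨁ (allFin n) (λ x → if eqᵇ x (g zero) then X (x ◂ (g ∘ suc)) else ε)
      ≈⟨ ⨁-allFin-δ (g zero) (λ x → X (x ◂ (g ∘ suc))) ⟩
    X (g zero ◂ (g ∘ suc))
      ≈⟨ X-cong (λ { zero → ≡.refl ; (suc i) → ≡.refl }) ⟩
    X g ∎
    where
    fix-head : ∀ x → ⨁ (allFuns k n) (λ d → if eqᵇ x (g zero) ∧ d ≗ᵇ (g ∘ suc) then X (x ◂ d) else ε)
                     ≈ (if eqᵇ x (g zero) then X (x ◂ (g ∘ suc)) else ε)
    fix-head x with eqᵇ x (g zero)
    ... | true  = ⨁-allFuns-δ (g ∘ suc) (λ d → X (x ◂ d))
                    (λ d≗d′ → X-cong λ { zero → ≡.refl ; (suc i) → d≗d′ i })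
    ... | false = ⨁-ε (allFuns k n)

  ⨁-bijection : ∀ {k n k′ n′} {Z : (Fin k → Fin n) → Bool} {Y : (Fin k′ → Fin n′) → Bool} →
                (β : SubsetBijection Z Y) → let open SubsetBijection β in
                (X : (Fin k′ → Fin n′) → Carrier) → Congruent _≗_ _≈_ X →
                ⨁ (allFuns k n) (λ d → if Z d then X (to d) else ε) ≈
                ⨁ (allFuns k′ n′) (λ c → if Y c then X c else ε)
  ⨁-bijection {k} {n} {k′} {n′} {Z} {Y} β X X-cong = begin
    ⨁ Ds (λ d → if Z d then X (to d) else ε)
      ≈⟨ ⨁-cong Ds (λ d → if-cong (Z d) (sym (⨁-allFuns-δ (to d) X X-cong))) ⟩
    ⨁ Ds (λ d → if Z d then ⨁ Cs (λ c → if c ≗ᵇ to d then X c else ε) else ε)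
      ≈⟨ ⨁-cong Ds (λ d → push-if (Z d)) ⟩
    ⨁ Ds (λ d → ⨁ Cs (λ c → if Z d ∧ c ≗ᵇ to d then X c else ε))
      ≈⟨ ⨁-comm Ds Cs _ ⟩
    ⨁ Cs (λ c → ⨁ Ds (λ d → if Z d ∧ c ≗ᵇ to d then X c else ε))
      ≈⟨ ⨁-cong Cs fibre ⟩
    ⨁ Cs (λ c → if Y c then X c else ε) ∎
    where
    open SubsetBijection β
    Ds = allFuns k n
    Cs = allFuns k′ n′
    push-if : ∀ {d} b → (if b then ⨁ Cs (λ c → if c ≗ᵇ to d then X c else ε) else ε)
                      ≈ ⨁ Cs (λ c → if b ∧ c ≗ᵇ to d then X c else ε)
    push-if true  = refl
    push-if false = sym (⨁-ε Cs)
    fibre : ∀ c → ⨁ Ds (λ d → if Z d ∧ c ≗ᵇ to d then X c else ε) ≈ (if Y c then X c else ε)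
    fibre c with Y c in Yc
    ... | true  = trans (⨁-cong Ds λ d → reflexive (≡.cong (λ b → if b then X c else ε) (fibre-on c Yc d)))
                        (⨁-allFuns-δ (from c) (λ _ → X c) (λ _ → refl))
    ... | false = trans (⨁-cong Ds λ d → reflexive (≡.cong (λ b → if b then X c else ε) (fibre-off c Yc d)))
                        (⨁-ε Ds)

module RingBigOperators {c ℓ} (R : CommutativeRing c ℓ) where

  open CommutativeRing R hiding (zero)
  open import Algebra.Properties.Ring ring using (-‿distribˡ-*; -0#≈0#; -‿+-comm)
  open import Relation.Binary.Reasoning.Setoid setoid

  module Σ = BigOperators +-commutativeMonoid
  module Π = BigOperators *-commutativeMonoid
  open Σ public using () renaming (⨁ to ΣL)
  open Π public using () renaming (⨁ to ΠL)

  ΣL-*ˡ : (xs : List I) (z : Carrier) (g : I → Carrier) → z * ΣL xs g ≈ ΣL xs (λ x → z * g x)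
  ΣL-*ˡ []       z g = zeroʳ z
  ΣL-*ˡ (x ∷ xs) z g = trans (distribˡ z _ _) (+-congˡ (ΣL-*ˡ xs z g))

  ΣL-*ʳ : (xs : List I) (z : Carrier) (g : I → Carrier) → ΣL xs g * z ≈ ΣL xs (λ x → g x * z)
  ΣL-*ʳ xs z g = trans (*-comm _ z) (trans (ΣL-*ˡ xs z g) (Σ.⨁-cong xs (λ x → *-comm z (g x))))

  ΣL-neg : (xs : List I) (g : I → Carrier) → ΣL xs (λ x → - g x) ≈ - ΣL xs g
  ΣL-neg []       g = sym -0#≈0#
  ΣL-neg (x ∷ xs) g = trans (+-congˡ (ΣL-neg xs g)) (-‿+-comm _ _)

  ΣL-const : ∀ n x → ΣL (allFin n) (λ _ → x) ≈ natMul R n x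
  ΣL-const ℕ.zero    x = refl
  ΣL-const (ℕ.suc n) x = trans (reflexive (Σ.⨁-allFin-suc n (λ _ → x))) (+-congˡ (ΣL-const n x))

  ΠL-if-0# : (xs : List I) (b : I → Bool) (u : I → Carrier) →
             ΠL xs (λ x → if b x then u x else 0#) ≈ (if allᵇ b xs then ΠL xs u else 0#)
  ΠL-if-0# []       b u = refl
  ΠL-if-0# (x ∷ xs) b u with b x
  ... | false = zeroˡ _
  ... | true with allᵇ b xs | ΠL-if-0# xs b u
  ...   | true  | ih = *-congˡ ih
  ...   | false | ih = trans (*-congˡ ih) (zeroʳ _)

  ΠL-ΣL : ∀ k n (Q : Fin k → Fin n → Carrier) →
          ΠL (allFin k) (λ i → ΣL (allFin n) (Q i)) ≈ ΣL (allFuns k n) (λ d → ΠL (allFin k) (λ i → Q i (d i)))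
  ΠL-ΣL ℕ.zero    n Q = sym (+-identityʳ 1#)
  ΠL-ΣL (ℕ.suc k) n Q = begin
    ΠL (allFin (ℕ.suc k)) (λ i → ΣL (allFin n) (Q i))
      ≡⟨ Π.⨁-allFin-suc k _ ⟩
    ΣL (allFin n) (Q zero) * ΠL (allFin k) (λ i → ΣL (allFin n) (Q (suc i)))
      ≈⟨ *-congˡ (ΠL-ΣL k n (Q ∘ suc)) ⟩
    ΣL (allFin n) (Q zero) * ΣL (allFuns k n) (λ d → ΠL (allFin k) (λ i → Q (suc i) (d i)))
      ≈⟨ ΣL-*ʳ (allFin n) _ (Q zero) ⟩
    ΣL (allFin n) (λ x → Q zero x * ΣL (allFuns k n) (λ d → ΠL (allFin k) (λ i → Q (suc i) (d i))))
      ≈⟨ Σ.⨁-cong (allFin n) (λ x → ΣL-*ˡ (allFuns k n) (Q zero x) _) ⟩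
    ΣL (allFin n) (λ x → ΣL (allFuns k n) (λ d → Q zero x * ΠL (allFin k) (λ i → Q (suc i) (d i))))
      ≈⟨ Σ.⨁-cong (allFin n) (λ x → Σ.⨁-cong (allFuns k n) (λ d → reflexive (Π.⨁-allFin-suc k _))) ⟨
    ΣL (allFin n) (λ x → ΣL (allFuns k n) (λ d → ΠL (allFin (ℕ.suc k)) (λ i → Q i ((x ◂ d) i))))
      ≈⟨ Σ.⨁-allFuns-suc _ (λ d≗d′ →
           Π.⨁-cong (allFin (ℕ.suc k)) (λ i → reflexive (≡.cong (Q i) (d≗d′ i)))) ⟨
    ΣL (allFuns (ℕ.suc k) n) (λ d → ΠL (allFin (ℕ.suc k)) (λ i → Q i (d i))) ∎

  if-*ˡ : ∀ b {x} z → z * (if b then x else 0#) ≈ (if b then z * x else 0#)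
  if-*ˡ true  z = refl
  if-*ˡ false z = zeroʳ z

  if-*ʳ : ∀ b {x} z → (if b then x else 0#) * z ≈ (if b then x * z else 0#)
  if-*ʳ true  z = refl
  if-*ʳ false z = zeroˡ z

  negPow-1# : ∀ m x → negPow R m x ≈ negPow R m 1# * x
  negPow-1# ℕ.zero    x = sym (*-identityˡ x)
  negPow-1# (ℕ.suc m) x = trans (-‿cong (negPow-1# m x)) (-‿distribˡ-* _ _)

module CycleProducts {c ℓ} (R : CommutativeRing c ℓ) {k : ℕ}
                     (σ : Fin k → Fin k) (σ-injective : Injective _≡_ _≡_ σ) where

  open CommutativeRing R hiding (zero)
  open RingBigOperators R
  open Cycles σ σ-injective
  open import Relation.Binary.Reasoning.Setoid setoid

  ΠL-orbit : ∀ {i} → isLeader σ i ≡ true → (G : Fin k → Fin k → Carrier) →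
             ΠL (orbit i) (G i) ≈ ΠL (allFin k) (λ r → if eqᵇ (lead r) i then G (lead r) r else 1#)
  ΠL-orbit {i} leader G = trans (Π.⨁-Unique (orbit-Unique i) (G i)) (Π.⨁-cong (allFin k) in-orbit)
    where
    in-orbit : ∀ r → (if does (r ∈? orbit i) then G i r else 1#) ≈ (if eqᵇ (lead r) i then G (lead r) r else 1#)
    in-orbit r with r ∈? orbit i
    ... | yes r∈ rewrite proj₁ (∈orbit⇔lead≡ leader) r∈ | eqᵇ-refl i = refl
    ... | no  r∉ rewrite ≢⇒eqᵇ-false (r∉ ∘ proj₂ (∈orbit⇔lead≡ {r = r} leader)) = refl

  ΠL-cycles : (G : Fin k → Fin k → Carrier) →
              ΠL (allFin k) (λ i → if isLeader σ i then ΠL (orbit i) (G i) else 1#) ≈ ΠL (allFin k) (λ r → G (lead r) r)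
  ΠL-cycles G = begin
    ΠL (allFin k) (λ i → if isLeader σ i then ΠL (orbit i) (G i) else 1#)
      ≈⟨ Π.⨁-cong (allFin k) (λ i → by-leader i (isLeader σ i) ≡.refl) ⟩
    ΠL (allFin k) (λ i → ΠL (allFin k) (λ r → if eqᵇ (lead r) i then G (lead r) r else 1#))
      ≈⟨ Π.⨁-comm (allFin k) (allFin k) _ ⟩
    ΠL (allFin k) (λ r → ΠL (allFin k) (λ i → if eqᵇ (lead r) i then G (lead r) r else 1#))
      ≈⟨ Π.⨁-cong (allFin k) (λ r → trans
           (Π.⨁-cong (allFin k) (λ i → reflexive (≡.cong (λ b → if b then G (lead r) r else 1#) (eqᵇ-sym (lead r) i))))
           (Π.⨁-allFin-δ (lead r) (λ _ → G (lead r) r))) ⟩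
    ΠL (allFin k) (λ r → G (lead r) r) ∎
    where
    not-lead : ∀ {i} → isLeader σ i ≡ false → ∀ r → eqᵇ (lead r) i ≡ false
    not-lead {i} non-leader r = ≢⇒eqᵇ-false λ lead≡i →
      case ≡.trans (≡.sym non-leader) (≡.subst (λ x → isLeader σ x ≡ true) lead≡i (lead-isLeader r)) of λ ()
    by-leader : ∀ i b → isLeader σ i ≡ b →
                (if b then ΠL (orbit i) (G i) else 1#) ≈ ΠL (allFin k) (λ r → if eqᵇ (lead r) i then G (lead r) r else 1#)
    by-leader i true  leader     = ΠL-orbit leader G
    by-leader i false non-leader = sym (trans
      (Π.⨁-cong (allFin k) (λ r → reflexive (≡.cong (λ b → if b then G (lead r) r else 1#) (not-lead non-leader r))))
      (Π.⨁-ε (allFin k)))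

module Sign {c ℓ} (R : CommutativeRing c ℓ) where

  open import Data.Nat.Base using (_<ᵇ_)
  open CommutativeRing R hiding (zero)
  open RingBigOperators R
  open Transpositions
  open Stabilisers
  open import Algebra.Properties.Ring ring using (-1*x≈-x; -‿distribˡ-*; -‿distribʳ-*; -‿involutive; -0#≈0#)
  open import Data.Fin.Permutation.Components using (transpose)
  open import Relation.Binary.Definitions using (tri<; tri≈; tri>)
  open import Relation.Binary.Reasoning.Setoid setoid

  sgn : ∀ {k} → (Fin k → Fin k) → Carrier
  sgn σ = negPow R (inversions σ) 1#

  _≺_ : ∀ {k} → Fin k → Fin k → Bool
  i ≺ j = toℕ i <ᵇ toℕ j

  pairSign : ∀ {k} → Fin k → Fin k → Carrier
  pairSign x y = if y ≺ x then - 1# else 1#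

  ΠL² : ∀ {k} → (Fin k → Fin k → Carrier) → Carrier
  ΠL² {k} F = ΠL (allFin k) (λ i → ΠL (allFin k) (F i))

  ΠL< : ∀ {k} → (Fin k → Fin k → Carrier) → Carrier
  ΠL< F = ΠL² (λ i j → if i ≺ j then F i j else 1#)

  signProduct : ∀ {k} → (Fin k → Fin k) → Carrier
  signProduct σ = ΠL< (λ i j → pairSign (σ i) (σ j))

  negPow-length-filter : (p : I → Bool) (xs : List I) →
                         negPow R (length (filterᵇ p xs)) 1# ≈ ΠL xs (λ x → if p x then - 1# else 1#)
  negPow-length-filter p []       = refl
  negPow-length-filter p (x ∷ xs) with p x
  ... | true  = trans (-‿cong (negPow-length-filter p xs)) (sym (-1*x≈-x _))
  ... | false = trans (negPow-length-filter p xs) (sym (*-identityˡ _))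

  sgn≈signProduct : ∀ {k} (σ : Fin k → Fin k) → sgn σ ≈ signProduct σ
  sgn≈signProduct {k} σ = trans (negPow-length-filter _ (cartesianProduct (allFin k) (allFin k)))
    (trans (Π.⨁-cartesianProduct (allFin k) (allFin k) _)
           (Π.⨁-cong (allFin k) λ i → Π.⨁-cong (allFin k) λ j → inversion (i ≺ j)))
    where
    inversion : ∀ {x} b → (if b ∧ x then - 1# else 1#) ≈ (if b then (if x then - 1# else 1#) else 1#)
    inversion true  = refl
    inversion false = refl

  module _ {k : ℕ} where

    ≺-irrefl : (x : Fin k) → x ≺ x ≡ false
    ≺-irrefl x = ≮⇒<ᵇ-false {toℕ x} (ℕ.<-irrefl ≡.refl)

    ≺-asym : {x y : Fin k} → x ≺ y ≡ true → y ≺ x ≡ false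
    ≺-asym {x} {y} x≺y = ≮⇒<ᵇ-false {toℕ y} (ℕ.<-asym (<ᵇ⇒< {toℕ x} x≺y))

    ≺-flip : {x y : Fin k} → x ≢ y → not (x ≺ y) ≡ y ≺ x
    ≺-flip {x} {y} x≢y with ℕ.<-cmp (toℕ x) (toℕ y)
    ... | tri< x<y _ _ rewrite <⇒<ᵇ x<y | ≮⇒<ᵇ-false (ℕ.<-asym x<y) = ≡.refl
    ... | tri≈ _ x≡y _ = ⊥-elim (x≢y (Fin.toℕ-injective x≡y))
    ... | tri> _ _ y<x rewrite <⇒<ᵇ y<x | ≮⇒<ᵇ-false (ℕ.<-asym y<x) = ≡.refl

    pairSign-antisym : {x y : Fin k} → x ≢ y → pairSign y x ≈ - pairSign x y
    pairSign-antisym {x} {y} x≢y with x ≺ y | ≺-flip x≢y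
    ... | true  | y⊀x rewrite ≡.sym y⊀x = refl
    ... | false | y≺x rewrite ≡.sym y≺x = sym (-‿involutive 1#)

    pairSign² : (x y : Fin k) → pairSign x y * pairSign x y ≈ 1#
    pairSign² x y with y ≺ x
    ... | true  = trans (-1*x≈-x (- 1#)) (-‿involutive 1#)
    ... | false = *-identityˡ 1#

    ≺⇒pairSign≈1# : {x y : Fin k} → x ≺ y ≡ true → pairSign x y ≈ 1#
    ≺⇒pairSign≈1# {x} {y} x≺y rewrite ≺-asym {x} {y} x≺y = refl

    ΠL²-cong : {F G : Fin k → Fin k → Carrier} → (∀ i j → F i j ≈ G i j) → ΠL² F ≈ ΠL² G
    ΠL²-cong F≈G = Π.⨁-cong (allFin k) (λ i → Π.⨁-cong (allFin k) (F≈G i))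

    ΠL²-* : (F G : Fin k → Fin k → Carrier) → ΠL² (λ i j → F i j * G i j) ≈ ΠL² F * ΠL² G
    ΠL²-* F G = trans (Π.⨁-cong (allFin k) (λ i → Π.⨁-distrib (allFin k) (F i) (G i))) (Π.⨁-distrib (allFin k) _ _)

    ΠL²-flip : (F : Fin k → Fin k → Carrier) → ΠL² F ≈ ΠL² (λ i j → F j i)
    ΠL²-flip F = Π.⨁-comm (allFin k) (allFin k) F

    ΠL²-permute : {σ : Fin k → Fin k} → Injective _≡_ _≡_ σ → (F : Fin k → Fin k → Carrier) →
                  ΠL² (λ i j → F (σ i) (σ j)) ≈ ΠL² F
    ΠL²-permute {σ} σ-inj F = trans (Π.⨁-cong (allFin k) (λ i → Π.⨁-permute σ-inj (F (σ i))))
                                (Π.⨁-permute σ-inj (λ x → ΠL (allFin k) (F x)))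

    ≺-reorder : {σ : Fin k → Fin k} → Injective _≡_ _≡_ σ →
                ∀ i j → (i ≺ j ∧ not (σ i ≺ σ j)) ≡ (σ j ≺ σ i ∧ not (j ≺ i))
    ≺-reorder {σ} σ-inj i j with ℕ.<-cmp (toℕ i) (toℕ j)
    ... | tri< i<j _ _ rewrite <⇒<ᵇ i<j | ≮⇒<ᵇ-false (ℕ.<-asym i<j) | Bool.∧-identityʳ (σ j ≺ σ i) =
      ≺-flip (λ σi≡σj → ℕ.<-irrefl (≡.cong toℕ (σ-inj σi≡σj)) i<j)
    ... | tri≈ _ i≡j _ rewrite Fin.toℕ-injective i≡j | ≺-irrefl j | ≺-irrefl (σ j) = ≡.refl
    ... | tri> _ _ j<i rewrite ≮⇒<ᵇ-false (ℕ.<-asym j<i) | <⇒<ᵇ j<i = ≡.sym (Bool.∧-zeroʳ _)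

    -- A symmetric H takes the same value on (i, j) and (j, i), so only the unordered pairs matter,
    -- and an injective σ just chooses the other orientation of some of them.
    ΠL<-reorder : {σ : Fin k → Fin k} → Injective _≡_ _≡_ σ →
                  (H : Fin k → Fin k → Carrier) → (∀ i j → H i j ≈ H j i) →
                  ΠL< H ≈ ΠL² (λ i j → if σ i ≺ σ j then H i j else 1#)
    ΠL<-reorder {σ} σ-inj H H-sym = begin
      ΠL² (λ i j → if A i j then H i j else 1#)
        ≈⟨ ΠL²-cong (λ i j → Π.if-split (A i j) (B i j) (H i j)) ⟩
      ΠL² (λ i j → (if A i j ∧ B i j then H i j else 1#) * (if A i j ∧ not (B i j) then H i j else 1#))
        ≈⟨ ΠL²-* _ _ ⟩
      ΠL² (λ i j → if A i j ∧ B i j then H i j else 1#) * ΠL² (λ i j → if A i j ∧ not (B i j) then H i j else 1#)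
        ≈⟨ *-cong (ΠL²-cong (λ i j → Π.if-congᵇ (Bool.∧-comm (A i j) (B i j)) refl)) flipped ⟩
      ΠL² (λ i j → if B i j ∧ A i j then H i j else 1#) * ΠL² (λ i j → if B i j ∧ not (A i j) then H i j else 1#)
        ≈⟨ ΠL²-* _ _ ⟨
      ΠL² (λ i j → (if B i j ∧ A i j then H i j else 1#) * (if B i j ∧ not (A i j) then H i j else 1#))
        ≈⟨ ΠL²-cong (λ i j → Π.if-split (B i j) (A i j) (H i j)) ⟨
      ΠL² (λ i j → if B i j then H i j else 1#) ∎
      where
      A B : Fin k → Fin k → Bool
      A i j = i ≺ j
      B i j = σ i ≺ σ j
      flipped : ΠL² (λ i j → if A i j ∧ not (B i j) then H i j else 1#) ≈
                ΠL² (λ i j → if B i j ∧ not (A i j) then H i j else 1#)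
      flipped = trans (ΠL²-cong (λ i j → Π.if-congᵇ (≺-reorder σ-inj i j) (H-sym i j)))
                      (sym (ΠL²-flip (λ i j → if B i j ∧ not (A i j) then H i j else 1#)))

    signProduct-cong : {σ τ : Fin k → Fin k} → σ ≗ τ → signProduct σ ≈ signProduct τ
    signProduct-cong σ≗τ = ΠL²-cong λ i j →
      reflexive (≡.cong₂ (λ x y → if i ≺ j then pairSign x y else 1#) (σ≗τ i) (σ≗τ j))

    signProduct-id : signProduct {k} id ≈ 1#
    signProduct-id =
      trans (ΠL²-cong ordered) (trans (Π.⨁-cong (allFin k) (λ _ → Π.⨁-ε (allFin k))) (Π.⨁-ε (allFin k)))
      where
      ordered : ∀ x y → (if x ≺ y then pairSign x y else 1#) ≈ 1#
      ordered x y with x ≺ y in x≺y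
      ... | true  = ≺⇒pairSign≈1# {x} {y} x≺y
      ... | false = refl

    -- pairSign (ρ x) (ρ y) = pairSign x y · φ x y with φ symmetric; by ΠL<-reorder the φ-factor
    -- does not see σ, and it equals signProduct ρ.
    signProduct-∘ : {ρ σ : Fin k → Fin k} → Injective _≡_ _≡_ ρ → Injective _≡_ _≡_ σ →
                    signProduct (ρ ∘ σ) ≈ signProduct σ * signProduct ρ
    signProduct-∘ {ρ} {σ} ρ-inj σ-inj = begin
      signProduct (ρ ∘ σ)
        ≈⟨ ΠL²-cong (λ i j → trans (Π.if-cong (i ≺ j) (factor (σ i) (σ j))) (if-* (i ≺ j))) ⟩
      ΠL² (λ i j → (if i ≺ j then pairSign (σ i) (σ j) else 1#) * (if i ≺ j then φ (σ i) (σ j) else 1#))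
        ≈⟨ ΠL²-* _ _ ⟩
      signProduct σ * ΠL< (λ i j → φ (σ i) (σ j))
        ≈⟨ *-congˡ (ΠL<-reorder σ-inj (λ i j → φ (σ i) (σ j)) (λ i j → φ-sym (σ i) (σ j))) ⟩
      signProduct σ * ΠL² (λ i j → if σ i ≺ σ j then φ (σ i) (σ j) else 1#)
        ≈⟨ *-congˡ (ΠL²-permute σ-inj (λ x y → if x ≺ y then φ x y else 1#)) ⟩
      signProduct σ * ΠL< φ
        ≈⟨ *-congˡ (trans (ΠL²-cong (λ x y → if-* (x ≺ y))) (ΠL²-* _ _)) ⟩
      signProduct σ * (signProduct {k} id * signProduct ρ)
        ≈⟨ *-congˡ (trans (*-congʳ signProduct-id) (*-identityˡ _)) ⟩
      signProduct σ * signProduct ρ ∎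
      where
      φ : Fin k → Fin k → Carrier
      φ x y = pairSign x y * pairSign (ρ x) (ρ y)
      φ-sym : ∀ x y → φ x y ≈ φ y x
      φ-sym x y with x Fin.≟ y
      ... | yes ≡.refl = refl
      ... | no x≢y = sym (trans (*-cong (pairSign-antisym x≢y) (pairSign-antisym (x≢y ∘ ρ-inj)))
                                (trans (sym (-‿distribˡ-* _ _)) (trans (-‿cong (sym (-‿distribʳ-* _ _))) (-‿involutive _))))
      factor : ∀ x y → pairSign (ρ x) (ρ y) ≈ pairSign x y * φ x y
      factor x y = sym (trans (sym (*-assoc _ _ _)) (trans (*-congʳ (pairSign² x y)) (*-identityˡ _)))
      if-* : ∀ b {u v} → (if b then u * v else 1#) ≈ (if b then u else 1#) * (if b then v else 1#)
      if-* true  = refl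
      if-* false = sym (*-identityˡ 1#)

    signProduct-conj : (π ρ : Fin k → Fin k) → (∀ r → π (π r) ≡ r) → Injective _≡_ _≡_ ρ →
                       signProduct (π ∘ ρ ∘ π) ≈ signProduct ρ
    signProduct-conj π ρ π²≡id ρ-inj = begin
      signProduct (π ∘ ρ ∘ π)                       ≈⟨ signProduct-∘ π-inj (λ e → π-inj (ρ-inj e)) ⟩
      signProduct (ρ ∘ π) * signProduct π           ≈⟨ *-congʳ (signProduct-∘ ρ-inj π-inj) ⟩
      (signProduct π * signProduct ρ) * signProduct π ≈⟨ *-congʳ (*-comm _ _) ⟩
      (signProduct ρ * signProduct π) * signProduct π ≈⟨ *-assoc _ _ _ ⟩
      signProduct ρ * (signProduct π * signProduct π) ≈⟨ *-congˡ (signProduct-∘ π-inj π-inj) ⟨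
      signProduct ρ * signProduct (π ∘ π)           ≈⟨ *-congˡ (trans (signProduct-cong π²≡id) signProduct-id) ⟩
      signProduct ρ * 1#                            ≈⟨ *-identityʳ _ ⟩
      signProduct ρ                                 ∎
      where
      π-inj = involutive⇒injective π²≡id

  signProduct-transpose₀₁ : ∀ {k} → signProduct (transpose {ℕ.suc (ℕ.suc k)} zero (suc zero)) ≈ - 1#
  signProduct-transpose₀₁ {k} = begin
    signProduct τ
      ≈⟨ ΠL²-cong {n} by-pair ⟩
    ΠL² {n} (λ i j → if eqᵇ i zero then (if eqᵇ j (suc zero) then - 1# else 1#) else 1#)
      ≈⟨ Π.⨁-cong (allFin n) row ⟩
    ΠL (allFin n) (λ i → if eqᵇ i zero then - 1# else 1#)
      ≈⟨ Π.⨁-allFin-δ {n} zero (λ _ → - 1#) ⟩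
    - 1# ∎
    where
    n = ℕ.suc (ℕ.suc k)
    τ : Fin n → Fin n
    τ = transpose zero (suc zero)
    row : ∀ (i : Fin n) → ΠL (allFin n) (λ j → if eqᵇ i zero then (if eqᵇ j (suc zero) then - 1# else 1#) else 1#)
                ≈ (if eqᵇ i zero then - 1# else 1#)
    row i with eqᵇ i zero
    ... | true  = Π.⨁-allFin-δ {n} (suc zero) (λ _ → - 1#)
    ... | false = Π.⨁-ε (allFin n)
    by-pair : ∀ (i j : Fin n) → (if i ≺ j then pairSign (τ i) (τ j) else 1#)
                      ≈ (if eqᵇ i zero then (if eqᵇ j (suc zero) then - 1# else 1#) else 1#)
    by-pair zero          zero          = refl
    by-pair zero          (suc zero)    = refl
    by-pair zero          (suc (suc j)) = refl
    by-pair (suc zero)    zero          = refl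
    by-pair (suc zero)    (suc zero)    = refl
    by-pair (suc zero)    (suc (suc j)) = refl
    by-pair (suc (suc i)) zero          = refl
    by-pair (suc (suc i)) (suc zero)    = refl
    by-pair (suc (suc i)) (suc (suc j)) with i ≺ j in i≺j
    ... | true  = ≺⇒pairSign≈1# {x = i} {j} i≺j
    ... | false = refl

  signProduct-transpose₀ : ∀ {k} {q : Fin (ℕ.suc k)} → q ≢ zero → signProduct (transpose zero q) ≈ - 1#
  signProduct-transpose₀ {ℕ.zero}  {zero}  q≢0 = ⊥-elim (q≢0 ≡.refl)
  signProduct-transpose₀ {ℕ.suc k} {zero}  q≢0 = ⊥-elim (q≢0 ≡.refl)
  signProduct-transpose₀ {ℕ.suc k} {suc q} _   = begin
    signProduct (transpose zero (suc q)) ≈⟨ signProduct-cong conjugate ⟩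
    signProduct (π ∘ τ ∘ π)              ≈⟨ signProduct-conj π τ (transpose-involutive _ _) (transpose-injective _ _) ⟩
    signProduct τ                        ≈⟨ signProduct-transpose₀₁ {k} ⟩
    - 1#                                 ∎
    where
    π τ : Fin (ℕ.suc (ℕ.suc k)) → Fin (ℕ.suc (ℕ.suc k))
    π = transpose (suc zero) (suc q)
    τ = transpose zero (suc zero)
    conjugate : transpose zero (suc q) ≗ π ∘ τ ∘ π
    conjugate r = ≡.sym (≡.trans (transpose-conjugate π (transpose-involutive _ _) zero (suc zero) r)
      (≡.cong₂ (λ x y → transpose x y r) (transpose-other {p = suc zero} {suc q} (λ ()) (λ ()))
                                          (transpose-matchˡ (suc zero) (suc q))))

  signProduct-transpose : ∀ {k} {p q : Fin k} → p ≢ q → signProduct (transpose p q) ≈ - 1#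
  signProduct-transpose {ℕ.suc k} {p} {q} p≢q = begin
    signProduct (transpose p q)                   ≈⟨ signProduct-cong conjugate ⟩
    signProduct (π ∘ transpose zero (π q) ∘ π)
      ≈⟨ signProduct-conj π (transpose zero (π q)) (transpose-involutive zero p) (transpose-injective zero (π q)) ⟩
    signProduct (transpose zero (π q))            ≈⟨ signProduct-transpose₀ πq≢0 ⟩
    - 1# ∎
    where
    π : Fin (ℕ.suc k) → Fin (ℕ.suc k)
    π = transpose zero p
    conjugate : transpose p q ≗ π ∘ transpose zero (π q) ∘ π
    conjugate r = ≡.sym (≡.trans (transpose-conjugate π (transpose-involutive zero p) zero (π q) r)
      (≡.cong₂ (λ x y → transpose x y r) (transpose-matchˡ zero p) (transpose-involutive zero p q)))
    πq≢0 : π q ≢ zero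
    πq≢0 πq≡0 = p≢q (≡.trans (≡.sym (transpose-matchˡ zero p))
                             (≡.trans (≡.cong π (≡.sym πq≡0)) (transpose-involutive zero p q)))

  sgn-transpose-∘ : ∀ {k} {σ : Fin k → Fin k} → Injective _≡_ _≡_ σ → ∀ {p q} → p ≢ q →
                    sgn (transpose p q ∘ σ) ≈ - sgn σ
  sgn-transpose-∘ {σ = σ} σ-inj {p} {q} p≢q = begin
    sgn (transpose p q ∘ σ)                    ≈⟨ sgn≈signProduct (transpose p q ∘ σ) ⟩
    signProduct (transpose p q ∘ σ)            ≈⟨ signProduct-∘ (transpose-injective p q) σ-inj ⟩
    signProduct σ * signProduct (transpose p q) ≈⟨ *-congˡ (signProduct-transpose p≢q) ⟩
    signProduct σ * - 1#                       ≈⟨ *-comm _ _ ⟩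
    - 1# * signProduct σ                       ≈⟨ -1*x≈-x _ ⟩
    - signProduct σ                            ≈⟨ -‿cong (sgn≈signProduct σ) ⟨
    - sgn σ                                    ∎

  sgn-cong : ∀ {k} → Congruent _≗_ _≈_ (sgn {k})
  sgn-cong {x = σ} {τ} σ≗τ = trans (sgn≈signProduct σ) (trans (signProduct-cong σ≗τ) (sym (sgn≈signProduct τ)))

  stabiliser-sgn-sum : ∀ {k n} (c : Fin k → Fin n) {p q : Fin k} → p ≢ q → c p ≡ c q →
                       (∀ {x} → x + x ≈ 0# → x ≈ 0#) →
                       ΣL (allFuns k k) (λ σ → if stabilises c σ then sgn σ else 0#) ≈ 0#
  stabiliser-sgn-sum {k} c {p} {q} p≢q cp≡cq halve = halve (trans (+-congʳ S≈-S) (-‿inverseˡ S))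
    where
    S = ΣL (allFuns k k) (λ σ → if stabilises c σ then sgn σ else 0#)
    flip-sign : ∀ σ → (if stabilises c σ then sgn (transpose p q ∘ σ) else 0#) ≈ - (if stabilises c σ then sgn σ else 0#)
    flip-sign σ with stabilises c σ in e
    ... | true  = sgn-transpose-∘ {σ = σ} (isInjectiveᵇ⇒Injective (proj₁ (∧-elim e))) p≢q
    ... | false = sym -0#≈0#
    S≈-S : S ≈ - S
    S≈-S = begin
      S
        ≈⟨ Σ.⨁-bijection (transpose∘-involution c cp≡cq) sgn sgn-cong ⟨
      ΣL (allFuns k k) (λ σ → if stabilises c σ then sgn (transpose p q ∘ σ) else 0#)
        ≈⟨ Σ.⨁-cong (allFuns k k) flip-sign ⟩
      ΣL (allFuns k k) (λ σ → - (if stabilises c σ then sgn σ else 0#))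
        ≈⟨ ΣL-neg (allFuns k k) _ ⟩
      - S ∎

module SumOfHomomorphisms {c ℓ a ℓa b ℓb} {K : CommutativeRing c ℓ}
    (A : CommAlgebra K a ℓa) (B : CommAlgebra K b ℓb) (n : ℕ)
    (fs : Fin n → CommutativeRing.Carrier (CommAlgebra.ring A) → CommutativeRing.Carrier (CommAlgebra.ring B))
    (fs-hom : ∀ j → IsAlgHom A B (fs j))
    (f : CommutativeRing.Carrier (CommAlgebra.ring A) → CommutativeRing.Carrier (CommAlgebra.ring B))
    (f≈Σfs : ∀ x → CommutativeRing._≈_ (CommAlgebra.ring B) (f x)
                                          (sumL (CommAlgebra.ring B) (map (λ j → fs j x) (allFin n))))
    where

  private
    RA = CommAlgebra.ring A
    RB = CommAlgebra.ring B
    module RA = CommutativeRing RA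
    module H (j : Fin n) = IsAlgHom (fs-hom j)
    module L (j : Fin n) = IsLinear (IsAlgHom.isLinear (fs-hom j))

  open CommutativeRing RB hiding (zero)
  open RingBigOperators RB
  open Sign RB using (sgn; stabiliser-sgn-sum)
  open Stabilisers using (stabilises)
  open import Relation.Binary.Reasoning.Setoid setoid

  isLinear : IsLinear A B f
  isLinear = record
    { cong   = λ {x} {y} x≈y → trans (f≈Σfs x) (trans (Σ.⨁-cong (allFin n) (λ j → L.cong j x≈y)) (sym (f≈Σfs y)))
    ; +-homo = λ x y → trans (f≈Σfs _) (trans (Σ.⨁-cong (allFin n) (λ j → L.+-homo j x y))
                         (trans (Σ.⨁-distrib (allFin n) _ _) (+-cong (sym (f≈Σfs x)) (sym (f≈Σfs y)))))
    ; •-homo = λ k x → trans (f≈Σfs _) (trans (Σ.⨁-cong (allFin n) (λ j → L.•-homo j k x))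
                         (trans (sym (ΣL-*ˡ (allFin n) _ _)) (*-congˡ (sym (f≈Σfs x)))))
    }

  unit : f RA.1# ≈ natMul RB n 1#
  unit = trans (f≈Σfs _) (trans (Σ.⨁-cong (allFin n) H.1-homo) (ΣL-const n 1#))

  fs-prodL : ∀ j (xs : List I) (g : I → RA.Carrier) → fs j (prodL RA (map g xs)) ≈ ΠL xs (fs j ∘ g)
  fs-prodL j []       g = H.1-homo j
  fs-prodL j (x ∷ xs) g = trans (H.*-homo j _ _) (*-congˡ (fs-prodL j xs g))

  colouredProduct : ∀ {k} → (Fin k → RA.Carrier) → (Fin k → Fin n) → Carrier
  colouredProduct {k} as c = ΠL (allFin k) (λ r → fs (c r) (as r))

  -- Giving every non-leader the fixed colour z₀ turns a choice of one colour per cycle of σ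
  -- into a function Fin k → Fin n, so that ΠL-ΣL applies.
  module Expansion {k} (z₀ : Fin n) (as : Fin k → RA.Carrier)
                   (σ : Fin k → Fin k) (σ-injective : Injective _≡_ _≡_ σ) where

    open Cycles σ σ-injective
    open CycleProducts RB σ σ-injective using (ΠL-cycles)

    cycleProduct≡ : ∀ i → cycleProduct A B σ as i ≡ prodL RA (map as (orbit i))
    cycleProduct≡ i = ≡.cong (prodL RA)
      (≡.trans (map-applyUpTo id _ (cycleLen σ i)) (≡.sym (map-applyUpTo _ as (cycleLen σ i))))

    Q : Fin k → Fin n → Carrier
    Q i j = if isLeader σ i then ΠL (orbit i) (fs j ∘ as) else (if eqᵇ j z₀ then 1# else 0#)

    leader-factor : ∀ i → (if isLeader σ i then f (cycleProduct A B σ as i) else 1#) ≈ ΣL (allFin n) (Q i)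
    leader-factor i with isLeader σ i
    ... | true  = trans (f≈Σfs _) (Σ.⨁-cong (allFin n) λ j →
                    trans (L.cong j (RA.reflexive (cycleProduct≡ i))) (fs-prodL j (orbit i) as))
    ... | false = sym (Σ.⨁-allFin-δ z₀ (λ _ → 1#))

    z₀OffLeaders : (Fin k → Fin n) → Bool
    z₀OffLeaders d = allᵇ (λ i → isLeader σ i ∨ eqᵇ (d i) z₀) (allFin k)

    isσInvariant : (Fin k → Fin n) → Bool
    isσInvariant c = (c ∘ σ) ≗ᵇ c

    extend restrict : (Fin k → Fin n) → (Fin k → Fin n)
    extend d = d ∘ lead
    restrict c i = if isLeader σ i then c i else z₀

    choice-product : ∀ d → ΠL (allFin k) (λ i → Q i (d i)) ≈
                           (if z₀OffLeaders d then colouredProduct as (extend d) else 0#)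
    choice-product d = begin
      ΠL (allFin k) (λ i → Q i (d i))
        ≈⟨ Π.⨁-cong (allFin k) (λ i → split (isLeader σ i) (d i)) ⟩
      ΠL (allFin k) (λ i → if isLeader σ i ∨ eqᵇ (d i) z₀
                           then (if isLeader σ i then ΠL (orbit i) (fs (d i) ∘ as) else 1#) else 0#)
        ≈⟨ ΠL-if-0# (allFin k) _ _ ⟩
      (if z₀OffLeaders d then ΠL (allFin k) (λ i → if isLeader σ i then ΠL (orbit i) (fs (d i) ∘ as) else 1#) else 0#)
        ≈⟨ Σ.if-cong (z₀OffLeaders d) (ΠL-cycles (λ i r → fs (d i) (as r))) ⟩
      (if z₀OffLeaders d then colouredProduct as (extend d) else 0#) ∎
      where
      split : ∀ b {x} j → (if b then x else (if eqᵇ j z₀ then 1# else 0#)) ≈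
                          (if b ∨ eqᵇ j z₀ then (if b then x else 1#) else 0#)
      split true  j = refl
      split false j with eqᵇ j z₀
      ... | true  = refl
      ... | false = refl

    invariant-iter : ∀ {c} → isσInvariant c ≡ true → ∀ m r → c (iter σ m r) ≡ c r
    invariant-iter inv ℕ.zero    r = ≡.refl
    invariant-iter inv (ℕ.suc m) r = ≡.trans (≗ᵇ⇒≗ inv (iter σ m r)) (invariant-iter inv m r)

    extend∘restrict : ∀ c → isσInvariant c ≡ true → extend (restrict c) ≗ c
    extend∘restrict c inv r rewrite lead-isLeader r with m , σᵐr≡lead ← ∈orbit⇒iter (lead∈orbit r) =
      ≡.trans (≡.cong c (≡.sym σᵐr≡lead)) (invariant-iter inv m r)

    restrict∘extend : ∀ d → z₀OffLeaders d ≡ true → restrict (extend d) ≗ d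
    restrict∘extend d off i with isLeader σ i in leader
    ... | true  = ≡.cong d (isLeader⇒lead≡ leader)
    ... | false =
      ≡.sym (eqᵇ⇒≡ (≡.subst (λ b → (b ∨ eqᵇ (d i) z₀) ≡ true) leader (allᵇ⁻ _ off (∈-allFin i))))

    choices≅invariants : SubsetBijection z₀OffLeaders isσInvariant
    choices≅invariants = record
      { to        = extend
      ; from      = restrict
      ; Z-cong    = λ d≗d′ → allᵇ-cong (allFin k) (λ i → ≡.cong (λ x → isLeader σ i ∨ eqᵇ x z₀) (d≗d′ i))
      ; Y-cong    = λ c≗c′ → ≗ᵇ-cong (c≗c′ ∘ σ) c≗c′
      ; to-cong   = λ d≗d′ → d≗d′ ∘ lead
      ; from-cong = λ c≗c′ i → ≡.cong (λ x → if isLeader σ i then x else z₀) (c≗c′ i)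
      ; to-Y      = λ d _ → ≗⇒≗ᵇ (≡.cong d ∘ lead-σ)
      ; from-Z    = λ c _ → allᵇ⁺ _ (allFin k) λ {i} _ → restrict-off c i (isLeader σ i)
      ; from∘to   = restrict∘extend
      ; to∘from   = extend∘restrict
      }
      where
      restrict-off : ∀ c i b → (b ∨ eqᵇ (if b then c i else z₀) z₀) ≡ true
      restrict-off c i true  = ≡.refl
      restrict-off c i false = eqᵇ-refl z₀

    fσ-expansion : fσ A B f σ as ≈ ΣL (allFuns k n) (λ c → if isσInvariant c then colouredProduct as c else 0#)
    fσ-expansion = begin
      fσ A B f σ as
        ≈⟨ Π.⨁-filter (isLeader σ) (allFin k) _ ⟩
      ΠL (allFin k) (λ i → if isLeader σ i then f (cycleProduct A B σ as i) else 1#)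
        ≈⟨ Π.⨁-cong (allFin k) leader-factor ⟩
      ΠL (allFin k) (λ i → ΣL (allFin n) (Q i))
        ≈⟨ ΠL-ΣL k n Q ⟩
      ΣL (allFuns k n) (λ d → ΠL (allFin k) (λ i → Q i (d i)))
        ≈⟨ Σ.⨁-cong (allFuns k n) choice-product ⟩
      ΣL (allFuns k n) (λ d → if z₀OffLeaders d then colouredProduct as (extend d) else 0#)
        ≈⟨ Σ.⨁-bijection choices≅invariants (colouredProduct as)
             (λ c≗c′ → Π.⨁-cong (allFin k) (λ r → reflexive (≡.cong (λ j → fs j (as r)) (c≗c′ r)))) ⟩
      ΣL (allFuns k n) (λ c → if isσInvariant c then colouredProduct as c else 0#) ∎

  Φ-expansion : Fin n → ∀ k (as : Fin k → RA.Carrier) →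
                Φ A B k f as ≈ ΣL (allFuns k n) (λ c →
                  ΣL (allFuns k k) (λ σ → if stabilises c σ then sgn σ else 0#) * colouredProduct as c)
  Φ-expansion z₀ k as = begin
    Φ A B k f as
      ≈⟨ Σ.⨁-filter isInjectiveᵇ (allFuns k k) _ ⟩
    ΣL (allFuns k k) (λ σ → if isInjectiveᵇ σ then negPow RB (inversions σ) (fσ A B f σ as) else 0#)
      ≈⟨ Σ.⨁-cong (allFuns k k) (λ σ → expand σ (isInjectiveᵇ σ) ≡.refl) ⟩
    ΣL (allFuns k k) (λ σ → ΣL (allFuns k n) (λ c → if stabilises c σ then sgn σ * colouredProduct as c else 0#))
      ≈⟨ Σ.⨁-comm (allFuns k k) (allFuns k n) _ ⟩
    ΣL (allFuns k n) (λ c → ΣL (allFuns k k) (λ σ → if stabilises c σ then sgn σ * colouredProduct as c else 0#))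
      ≈⟨ Σ.⨁-cong (allFuns k n) (λ c → trans (Σ.⨁-cong (allFuns k k) (λ σ → sym (if-*ʳ (stabilises c σ) _)))
                                              (sym (ΣL-*ʳ (allFuns k k) _ _))) ⟩
    ΣL (allFuns k n) (λ c → ΣL (allFuns k k) (λ σ → if stabilises c σ then sgn σ else 0#) * colouredProduct as c) ∎
    where
    expand : ∀ σ b → isInjectiveᵇ σ ≡ b →
             (if b then negPow RB (inversions σ) (fσ A B f σ as) else 0#) ≈
             ΣL (allFuns k n) (λ c → if b ∧ (c ∘ σ) ≗ᵇ c then sgn σ * colouredProduct as c else 0#)
    expand σ false _   = sym (Σ.⨁-ε (allFuns k n))
    expand σ true  inj = begin
      negPow RB (inversions σ) (fσ A B f σ as)
        ≈⟨ negPow-1# (inversions σ) _ ⟩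
      sgn σ * fσ A B f σ as
        ≈⟨ *-congˡ (Expansion.fσ-expansion z₀ as σ (isInjectiveᵇ⇒Injective inj)) ⟩
      sgn σ * ΣL (allFuns k n) (λ c → if (c ∘ σ) ≗ᵇ c then colouredProduct as c else 0#)
        ≈⟨ ΣL-*ˡ (allFuns k n) (sgn σ) _ ⟩
      ΣL (allFuns k n) (λ c → sgn σ * (if (c ∘ σ) ≗ᵇ c then colouredProduct as c else 0#))
        ≈⟨ Σ.⨁-cong (allFuns k n) (λ c → if-*ˡ ((c ∘ σ) ≗ᵇ c) (sgn σ)) ⟩
      ΣL (allFuns k n) (λ c → if (c ∘ σ) ≗ᵇ c then sgn σ * colouredProduct as c else 0#) ∎

  Φ₁-zero : (∀ x → f x ≈ 0#) → ∀ as → Φ A B 1 f as ≈ 0#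
  Φ₁-zero f≈0 as = trans (+-congʳ (trans (*-congʳ (f≈0 _)) (zeroˡ _))) (+-identityˡ _)

  Φ-vanishes-with-colour : (∀ {x} → x + x ≈ 0# → x ≈ 0#) → Fin n → ∀ as → Φ A B (ℕ.suc n) f as ≈ 0#
  Φ-vanishes-with-colour halve z₀ as = begin
    Φ A B (ℕ.suc n) f as
      ≈⟨ Φ-expansion z₀ (ℕ.suc n) as ⟩
    ΣL (allFuns (ℕ.suc n) n) (λ c → ΣL (allFuns (ℕ.suc n) (ℕ.suc n)) (λ σ → if stabilises c σ then sgn σ else 0#)
                                      * colouredProduct as c)
      ≈⟨ Σ.⨁-cong (allFuns (ℕ.suc n) n) (λ c → trans (*-congʳ (repeated c)) (zeroˡ _)) ⟩
    ΣL (allFuns (ℕ.suc n) n) (λ _ → 0#)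
      ≈⟨ Σ.⨁-ε (allFuns (ℕ.suc n) n) ⟩
    0# ∎
    where
    repeated : ∀ c → ΣL (allFuns (ℕ.suc n) (ℕ.suc n)) (λ σ → if stabilises c σ then sgn σ else 0#) ≈ 0#
    repeated c with p , q , p<q , cp≡cq ← Fin.pigeonhole (ℕ.n<1+n n) c = stabiliser-sgn-sum c (Fin.<⇒≢ p<q) cp≡cq halve

  private
    zero-or-inhabited : ∀ m → m ≡ 0 ⊎ Fin m
    zero-or-inhabited ℕ.zero    = inj₁ ≡.refl
    zero-or-inhabited (ℕ.suc m) = inj₂ zero

  Φ-vanishes : (∀ {x} → x + x ≈ 0# → x ≈ 0#) → ∀ as → Φ A B (ℕ.suc n) f as ≈ 0#
  Φ-vanishes halve with zero-or-inhabited n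
  ... | inj₂ z₀  = Φ-vanishes-with-colour halve z₀
  ... | inj₁ n≡0 =
    ≡.subst (λ m → ∀ (as : Fin (ℕ.suc m) → RA.Carrier) → Φ A B (ℕ.suc m) f as ≈ 0#) (≡.sym n≡0)
      (Φ₁-zero λ x → trans (f≈Σfs x) (Σ.⨁-allFin-0 n≡0 (λ j → fs j x)))

module _ {c ℓ b ℓb} {K : CommutativeRing c ℓ} (isField : IsField K) (charZero : CharZero K)
         (B : CommAlgebra K b ℓb) where

  private
    module K = CommutativeRing K
    module ι = IsRingHomomorphism (CommAlgebra.ι-hom B)
    ι = CommAlgebra.ι B
  open CommutativeRing (CommAlgebra.ring B)
  open import Relation.Binary.Reasoning.Setoid setoid

  two-invertible : ∃ λ h → h * (1# + 1#) ≈ 1#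
  two-invertible with y , 2y≈1 ← IsField.inverse isField (natMul K 2 K.1#) (charZero 1) = ι y , (begin
    ι y * (1# + 1#)                     ≈⟨ *-congˡ (+-congˡ (+-identityʳ 1#)) ⟨
    ι y * (1# + (1# + 0#))              ≈⟨ *-congˡ (+-cong ι.1#-homo (+-cong ι.1#-homo ι.0#-homo)) ⟨
    ι y * (ι K.1# + (ι K.1# + ι K.0#))  ≈⟨ *-congˡ (+-congˡ (ι.+-homo _ _)) ⟨
    ι y * (ι K.1# + ι (K.1# K.+ K.0#))  ≈⟨ *-congˡ (ι.+-homo _ _) ⟨
    ι y * ι (natMul K 2 K.1#)           ≈⟨ ι.*-homo _ _ ⟨
    ι (y K.* natMul K 2 K.1#)           ≈⟨ ι.⟦⟧-cong (K.trans (K.*-comm _ _) 2y≈1) ⟩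
    ι K.1#                              ≈⟨ ι.1#-homo ⟩
    1#                                  ∎)

  x+x≈0⇒x≈0 : ∀ {x} → x + x ≈ 0# → x ≈ 0#
  x+x≈0⇒x≈0 {x} x+x≈0 with h , 2h≈1 ← two-invertible = begin
    x                    ≈⟨ *-identityˡ x ⟨
    1# * x               ≈⟨ *-congʳ 2h≈1 ⟨
    (h * (1# + 1#)) * x  ≈⟨ *-assoc _ _ _ ⟩
    h * ((1# + 1#) * x)  ≈⟨ *-congˡ (trans (distribʳ x 1# 1#) (+-cong (*-identityˡ x) (*-identityˡ x))) ⟩
    h * (x + x)          ≈⟨ *-congˡ x+x≈0 ⟩
    h * 0#               ≈⟨ zeroʳ h ⟩
    0#                   ∎

corollary2p10 : ∀ {c ℓ a ℓa b ℓb} (K : CommutativeRing c ℓ) → IsField K → CharZero K →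
    (A : CommAlgebra K a ℓa) (B : CommAlgebra K b ℓb) (n : ℕ) →
    (fs : Fin n → CommutativeRing.Carrier (CommAlgebra.ring A) → CommutativeRing.Carrier (CommAlgebra.ring B)) →
    (∀ i → IsAlgHom A B (fs i)) →
    (f : CommutativeRing.Carrier (CommAlgebra.ring A) → CommutativeRing.Carrier (CommAlgebra.ring B)) →
    (∀ x → CommutativeRing._≈_ (CommAlgebra.ring B) (f x) (sumL (CommAlgebra.ring B) (map (λ i → fs i x) (allFin n)))) →
    IsFrobeniusHom A B n f
corollary2p10 K isField charZero A B n fs fs-hom f f≈Σfs = record
  { isLinear = isLinear
  ; Φ-vanish = Φ-vanishes (x+x≈0⇒x≈0 isField charZero B)
  ; unit     = unit
  }
  where open SumOfHomomorphisms A B n fs fs-hom f f≈Σfs
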